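{- Let $(\alpha_n)_{n\ge0}$ be a sequence of complex numbers, $A_n(x)=\sum_{\nu=0}^{n}\binom{n}{\nu}\alpha_{n-\nu}x^\nu$, and assume $A_m(1-x)=(-1)^mA_m(x)$ for all $m\ge0$. For $n\ge0$, $j\in\mathbb{Z}$ let $G_{n,j}(x)=x^jA_n(x^{ -1})$. Then for $n\ge k\ge0$, $$G_{n,2k}^{(k)}(1)=(-1)^nk!\sum_{\nu=0}^{k}\binom{2k-\nu}{k}\binom{n}{\nu}\alpha_{n-\nu}.$$ The numbers $\omega_{n,k}=G_{n,2k}^{(k)}(1)$ satisfy, for $n\ge2$ and $0\le k\le n-2$, $$\omega_{n,k+2}=(4k+6)\,\omega_{n,k+1}+n(n-1)\,\omega_{n-2,k}.$$ For odd $n\ge1$, there is a unique polynomial $F_n(u)=\sum_{k\ge0}h_{n,k}\frac{u^k}{k!}$ with $A_n(x)=(2x-1)F_n(x(x-1))$, and its coefficients satisfy $h_{n,k}=(-1)^k\omega_{n,k}$ for $0\le k\le\lfloor n/2\rfloor$.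
   Context: $\alpha_0=0$ is allowed. $G^{(k)}$ is the $k$-th derivative with respect to $x$. -}

module Defs where

open import Level using (_⊔_)
open import Algebra.Bundles using (CommutativeRing)
open import Data.Nat as ℕ using (ℕ; zero; suc; _∸_; _≤_) renaming (_+_ to _+ℕ_)
open import Data.Nat.Combinatorics using (_C_)
open import Data.Integer as ℤ using (ℤ; +_; -[1+_])
open import Data.List using (List; []; _∷_; map; foldr; upTo)
open import Data.Product using (_×_; _,_; ∃)
open import Relation.Nullary using (¬_)

module Poly {c ℓ : Level.Level} (R : CommutativeRing c ℓ) where
  open CommutativeRing R

  natR : ℕ → Carrier
  natR zero = 0#
  natR (suc n) = 1# + natR n

  _·_ : ℕ → Carrier → Carrier
  n · x = natR n * x
  infixl 7 _·_

  intR : ℤ → Carrier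
  intR (+ n) = natR n
  intR -[1+ n ] = - natR (suc n)

  _^_ : Carrier → ℕ → Carrier
  x ^ zero = 1#
  x ^ suc n = x * (x ^ n)

  sign : ℕ → Carrier
  sign zero = 1#
  sign (suc n) = - sign n

  sumTo : ℕ → (ℕ → Carrier) → Carrier
  sumTo zero f = f 0
  sumTo (suc n) f = sumTo n f + f (suc n)

  A : (ℕ → Carrier) → ℕ → Carrier → Carrier
  A α n x = sumTo n (λ ν → (n C ν) · (α (n ∸ ν) * (x ^ ν)))

  -- Laurent polynomials: finite lists of terms c·x^m with m ∈ ℤ.
  Laurent : Set c
  Laurent = List (Carrier × ℤ)

  deriv : Laurent → Laurent
  deriv = map (λ { (a , m) → (intR m * a , m ℤ.- ℤ.+ 1) })

  derivN : ℕ → Laurent → Laurent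
  derivN zero p = p
  derivN (suc k) p = deriv (derivN k p)

  -- evaluation at x = 1 (1^m = 1 for every m ∈ ℤ)
  evalAt1 : Laurent → Carrier
  evalAt1 = foldr (λ { (a , m) s → a + s }) 0#

  -- G_{n,j}(x) = x^j A_n(x^{-1}) = Σ_{ν=0}^{n} binom(n,ν) α_{n-ν} x^{j-ν}
  G : (ℕ → Carrier) → ℕ → ℤ → Laurent
  G α n j = map (λ ν → ((n C ν) · α (n ∸ ν) , j ℤ.- (+ ν))) (upTo (suc n))

  ω : (ℕ → Carrier) → ℕ → ℕ → Carrier
  ω α n k = evalAt1 (derivN k (G α n (+ (k +ℕ k))))

  polyEval : ℕ → (ℕ → Carrier) → Carrier → Carrier
  polyEval d cf u = sumTo d (λ k → cf k * (u ^ k))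

  SupportedBy : ℕ → (ℕ → Carrier) → Set ℓ
  SupportedBy d cf = ∀ k → d ℕ.< k → cf k ≈ 0#

-- A field of characteristic zero (the stdlib has no Field bundle).
-- The complex numbers are the intended instance.
record CharZeroField (c ℓ : Level.Level) : Set (Level.suc (c ⊔ ℓ)) where
  field
    ring : CommutativeRing c ℓ
    1≉0      : ¬ (CommutativeRing._≈_ ring (CommutativeRing.1# ring) (CommutativeRing.0# ring))
    inverse  : ∀ x → ¬ (CommutativeRing._≈_ ring x (CommutativeRing.0# ring)) →
               ∃ λ y → CommutativeRing._≈_ ring (CommutativeRing._*_ ring x y) (CommutativeRing.1# ring)
    charZero : ∀ n → ¬ (CommutativeRing._≈_ ring (Poly.natR ring (suc n)) (CommutativeRing.0# ring))

module Submission where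

-- Differentiating x^{2k-ν} k times and evaluating at 1 gives
-- ω_{n,k} = Σ_ν (2k-ν)^{(k)} C(n,ν) α_{n-ν}, with z^{(k)} the falling factorial. Newton's
-- expansion of (2k-ν)^{(k)} in the binomials C(ν,j) turns this into a combination of the
-- sums Σ_ν C(ν,j) C(n,ν) α_{n-ν}, which are the coefficients of A_n(1-x); the symmetry
-- A_n(1-x) = (-1)^n A_n(x) collapses them to (-1)^{n-j} C(n,j) α_{n-j}, while the Newton
-- weights become k! C(2k-j,k).
-- The recurrence holds term by term, from (z+2)(z+1) = (4k+6)(z-k) + ν(ν-1) for z = 2k+2-ν
-- and ν(ν-1) C(n,ν) = n(n-1) C(n-2,ν-2).
-- For odd n, 2A_n(x) = A_n(x) - A_n(1-x) = Σ_ν C(n,ν) α_{n-ν} (x^ν - (1-x)^ν), and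
-- x^ν - (1-x)^ν = (2x-1) L_ν(x(x-1)) for the Fibonacci polynomials L_ν; this gives F_n, which
-- is unique because a polynomial vanishing at all j(j+1) is zero. Since k! [u^k] L_ν is
-- (-1)^k (2k-ν)^{(k)} for ν > k and 0 for ν ≤ 2k, the sum defining k! h_{n,k} is (-1)^k times
-- ω_{n,k} minus its terms with ν ≤ k, and by the closed form those terms add up to -ω_{n,k}.

open import Defs
open import Level using (_⊔_)
open import Algebra.Bundles using (CommutativeRing)
open import Data.Nat as ℕ using (ℕ; zero; suc; _≤_; _<_; _∸_; _!; z≤n; s≤s) renaming (_*_ to _*ℕ_; _+_ to _+ℕ_)
import Data.Nat.Properties as ℕP
import Data.Nat.Tactic.RingSolver as ℕ-Solver
open import Data.Nat.Combinatorics using (_C_; k>n⇒nCk≡0; nC1≡n; nCk+nC[k+1]≡[n+1]C[k+1])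
open import Data.Integer as ℤ using (ℤ; -[1+_]; _⊖_)
import Data.Integer.Properties as ℤP
open import Data.Sign as Sign using (Sign)
open import Data.List using ([]; _∷_; map; applyUpTo)
open import Data.Maybe using (Maybe; just; nothing)
open import Data.Product using (_×_; ∃; Σ; _,_; proj₁; proj₂)
open import Data.Sum using (inj₁; inj₂; [_,_])
open import Relation.Binary.PropositionalEquality as ≡ using (_≡_)
open import Relation.Nullary using (¬_; yes; no)

[1+k]*[1+n]C[1+k]≡[1+n]*nCk : ∀ n k → suc k *ℕ (suc n C suc k) ≡ suc n *ℕ (n C k)
[1+k]*[1+n]C[1+k]≡[1+n]*nCk zero zero = ≡.refl
[1+k]*[1+n]C[1+k]≡[1+n]*nCk zero (suc k) = begin
  suc (suc k) *ℕ (1 C suc (suc k)) ≡⟨ ≡.cong (suc (suc k) *ℕ_) (k>n⇒nCk≡0 {1} {suc (suc k)} (s≤s (s≤s z≤n))) ⟩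
  suc (suc k) *ℕ 0                 ≡⟨ ℕP.*-zeroʳ (suc (suc k)) ⟩
  0                                ≡⟨ ≡.sym (k>n⇒nCk≡0 {0} {suc k} (s≤s z≤n)) ⟩
  0 C suc k                        ≡⟨ ≡.sym (ℕP.*-identityˡ _) ⟩
  1 *ℕ (0 C suc k)                 ∎
  where open ≡.≡-Reasoning
[1+k]*[1+n]C[1+k]≡[1+n]*nCk (suc n) zero =
  ≡.trans (ℕP.*-identityˡ _) (≡.trans (nC1≡n (suc (suc n))) (≡.sym (ℕP.*-identityʳ _)))
[1+k]*[1+n]C[1+k]≡[1+n]*nCk (suc n) (suc k) = begin
  suc (suc k) *ℕ (suc (suc n) C suc (suc k))          ≡⟨ ≡.cong (suc (suc k) *ℕ_) (≡.sym (nCk+nC[k+1]≡[n+1]C[k+1] (suc n) (suc k))) ⟩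
  suc (suc k) *ℕ (X +ℕ Y)                           ≡⟨ expand k X Y ⟩
  suc k *ℕ X +ℕ X +ℕ suc (suc k) *ℕ Y                  ≡⟨ ≡.cong₂ (λ p q → p +ℕ X +ℕ q) (IH k) (IH (suc k)) ⟩
  suc n *ℕ (n C k) +ℕ X +ℕ suc n *ℕ (n C suc k)      ≡⟨ collect (suc n) X (n C k) (n C suc k) ⟩
  suc n *ℕ (n C k +ℕ n C suc k) +ℕ X                ≡⟨ ≡.cong (λ p → suc n *ℕ p +ℕ X) (nCk+nC[k+1]≡[n+1]C[k+1] n k) ⟩
  suc n *ℕ X +ℕ X                                   ≡⟨ ℕP.+-comm (suc n *ℕ X) X ⟩
  suc (suc n) *ℕ X                                  ∎
  where
  open ≡.≡-Reasoning
  X = suc n C suc k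
  Y = suc n C suc (suc k)
  IH = [1+k]*[1+n]C[1+k]≡[1+n]*nCk n
  expand : ∀ a x y → suc (suc a) *ℕ (x +ℕ y) ≡ suc a *ℕ x +ℕ x +ℕ suc (suc a) *ℕ y
  expand = ℕ-Solver.solve-∀
  collect : ∀ b x u v → b *ℕ u +ℕ x +ℕ b *ℕ v ≡ b *ℕ (u +ℕ v) +ℕ x
  collect = ℕ-Solver.solve-∀

[2+k][1+k]*[2+n]C[2+k]≡[2+n][1+n]*nCk : ∀ n k →
  suc (suc k) *ℕ suc k *ℕ (suc (suc n) C suc (suc k)) ≡ suc (suc n) *ℕ suc n *ℕ (n C k)
[2+k][1+k]*[2+n]C[2+k]≡[2+n][1+n]*nCk n k = begin
  suc (suc k) *ℕ suc k *ℕ (suc (suc n) C suc (suc k))    ≡⟨ ≡.cong (_*ℕ (suc (suc n) C suc (suc k))) (ℕP.*-comm (suc (suc k)) (suc k)) ⟩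
  suc k *ℕ suc (suc k) *ℕ (suc (suc n) C suc (suc k))    ≡⟨ ℕP.*-assoc (suc k) (suc (suc k)) (suc (suc n) C suc (suc k)) ⟩
  suc k *ℕ (suc (suc k) *ℕ (suc (suc n) C suc (suc k)))  ≡⟨ ≡.cong (suc k *ℕ_) ([1+k]*[1+n]C[1+k]≡[1+n]*nCk (suc n) (suc k)) ⟩
  suc k *ℕ (suc (suc n) *ℕ (suc n C suc k))              ≡⟨ *-CS.x∙yz≈y∙xz (suc k) (suc (suc n)) (suc n C suc k) ⟩
  suc (suc n) *ℕ (suc k *ℕ (suc n C suc k))              ≡⟨ ≡.cong (suc (suc n) *ℕ_) ([1+k]*[1+n]C[1+k]≡[1+n]*nCk n k) ⟩
  suc (suc n) *ℕ (suc n *ℕ (n C k))                      ≡⟨ ℕP.*-assoc (suc (suc n)) (suc n) (n C k) ⟨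
  suc (suc n) *ℕ suc n *ℕ (n C k)                        ∎
  where
  open ≡.≡-Reasoning
  import Algebra.Properties.CommutativeSemigroup ℕP.*-commutativeSemigroup as *-CS

-- L_ν(u) = Σ_k fibCoeff ν k uᵏ, where L₀ = 0, L₁ = 1 and L_{ν+2}(u) = L_{ν+1}(u) + u L_ν(u).
fibCoeff : ℕ → ℕ → ℕ
fibCoeff zero k = 0
fibCoeff (suc zero) zero = 1
fibCoeff (suc zero) (suc k) = 0
fibCoeff (suc (suc ν)) zero = fibCoeff (suc ν) zero
fibCoeff (suc (suc ν)) (suc k) = fibCoeff (suc ν) (suc k) +ℕ fibCoeff ν k

fibCoeff-[1+ν]-0 : ∀ ν → fibCoeff (suc ν) 0 ≡ 1
fibCoeff-[1+ν]-0 zero = ≡.refl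
fibCoeff-[1+ν]-0 (suc ν) = fibCoeff-[1+ν]-0 ν

fibCoeff-vanishes : ∀ ν k → ν ≤ k +ℕ k → fibCoeff ν k ≡ 0
fibCoeff-vanishes zero k _ = ≡.refl
fibCoeff-vanishes (suc zero) (suc k) _ = ≡.refl
fibCoeff-vanishes (suc (suc ν)) (suc k) (s≤s ν<2k+2) =
  ≡.cong₂ _+ℕ_ (fibCoeff-vanishes (suc ν) (suc k) (ℕP.m≤n⇒m≤1+n ν<2k+2))
               (fibCoeff-vanishes ν k (ℕP.≤-pred (≡.subst (suc ν ≤_) (ℕP.+-suc k k) ν<2k+2)))

module Identities {c ℓ} (R : CommutativeRing c ℓ) where
  open CommutativeRing R
  open Poly R
  open import Algebra.Properties.Ring ring using (-0#≈0#; -1*x≈-x; -‿involutive)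
  open import Algebra.Properties.AbelianGroup +-abelianGroup using (⁻¹-∙-comm; x∙y⁻¹≈ε⇒x≈y; x≈y⇒x∙y⁻¹≈ε)
  open import Algebra.Properties.Semiring.Mult semiring using (×-homo-+; ×1-homo-*) renaming (_×_ to _×ᴿ_)
  import Algebra.Properties.CommutativeSemigroup +-commutativeSemigroup as +-CS
  import Algebra.Properties.CommutativeSemigroup *-commutativeSemigroup as *-CS
  open import Relation.Binary.Reasoning.Setoid setoid
  import Algebra.Solver.Ring.AlmostCommutativeRing as ACR

  natR≡×1# : ∀ n → natR n ≡ n ×ᴿ 1#
  natR≡×1# zero = ≡.refl
  natR≡×1# (suc n) = ≡.cong (1# +_) (natR≡×1# n)

  natR-+ : ∀ m n → natR (m +ℕ n) ≈ natR m + natR n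
  natR-+ m n rewrite natR≡×1# m | natR≡×1# n | natR≡×1# (m +ℕ n) = ×-homo-+ 1# m n

  natR-* : ∀ m n → natR (m *ℕ n) ≈ natR m * natR n
  natR-* m n rewrite natR≡×1# m | natR≡×1# n | natR≡×1# (m *ℕ n) = ×1-homo-* m n

  -‿+-distrib : ∀ x y → - (x + y) ≈ - x + - y
  -‿+-distrib x y = sym (⁻¹-∙-comm x y)

  intR-⊖ : ∀ m n → intR (m ⊖ n) ≈ natR m - natR n
  intR-⊖ zero zero = sym (-‿inverseʳ 0#)
  intR-⊖ zero (suc n) = sym (+-identityˡ _)
  intR-⊖ (suc m) zero = sym (trans (+-congˡ -0#≈0#) (+-identityʳ _))
  intR-⊖ (suc m) (suc n) = begin
    intR (suc m ⊖ suc n)                  ≡⟨ ≡.cong intR (ℤP.[1+m]⊖[1+n]≡m⊖n m n) ⟩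
    intR (m ⊖ n)                          ≈⟨ intR-⊖ m n ⟩
    natR m - natR n                       ≈⟨ +-identityˡ _ ⟨
    0# + (natR m - natR n)                ≈⟨ +-congʳ (-‿inverseʳ 1#) ⟨
    (1# - 1#) + (natR m - natR n)         ≈⟨ +-CS.interchange 1# (- 1#) (natR m) (- natR n) ⟩
    (1# + natR m) + (- 1# + - natR n)     ≈⟨ +-congˡ (-‿+-distrib 1# (natR n)) ⟨
    natR (suc m) - natR (suc n)           ∎

  intR-+ : ∀ a b → intR (a ℤ.+ b) ≈ intR a + intR b
  intR-+ (ℤ.+ m) (ℤ.+ n) = natR-+ m n
  intR-+ (ℤ.+ m) -[1+ n ] = intR-⊖ m (suc n)
  intR-+ -[1+ m ] (ℤ.+ n) = trans (intR-⊖ n (suc m)) (+-comm _ _)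
  intR-+ -[1+ m ] -[1+ n ] = begin
    - natR (suc (suc (m +ℕ n)))          ≡⟨ ≡.cong (λ t → - natR (suc t)) (ℕP.+-suc m n) ⟨
    - natR (suc m +ℕ suc n)              ≈⟨ -‿cong (natR-+ (suc m) (suc n)) ⟩
    - (natR (suc m) + natR (suc n))      ≈⟨ -‿+-distrib _ _ ⟩
    - natR (suc m) + - natR (suc n)      ∎

  intR-neg : ∀ z → intR (ℤ.- z) ≈ - intR z
  intR-neg (ℤ.+ zero) = sym -0#≈0#
  intR-neg (ℤ.+ suc n) = refl
  intR-neg -[1+ n ] = sym (-‿involutive _)

  signR : Sign → Carrier
  signR Sign.+ = 1#
  signR Sign.- = - 1#

  signR-* : ∀ s t → signR (s Sign.* t) ≈ signR s * signR t
  signR-* Sign.+ t = sym (*-identityˡ _)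
  signR-* Sign.- Sign.+ = sym (*-identityʳ _)
  signR-* Sign.- Sign.- = sym (trans (-1*x≈-x _) (-‿involutive _))

  intR-◃ : ∀ s n → intR (s ℤ.◃ n) ≈ signR s * natR n
  intR-◃ s zero = sym (zeroʳ _)
  intR-◃ Sign.+ (suc n) = sym (*-identityˡ _)
  intR-◃ Sign.- (suc n) = sym (-1*x≈-x _)

  intR≈sign*abs : ∀ z → intR z ≈ signR (ℤ.sign z) * natR ℤ.∣ z ∣
  intR≈sign*abs (ℤ.+ n) = sym (*-identityˡ _)
  intR≈sign*abs -[1+ n ] = sym (-1*x≈-x _)

  intR-* : ∀ a b → intR (a ℤ.* b) ≈ intR a * intR b
  intR-* a b = begin
    intR (a ℤ.* b)                                                      ≈⟨ intR-◃ (sa Sign.* sb) (ℤ.∣ a ∣ ℕ.* ℤ.∣ b ∣) ⟩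
    signR (sa Sign.* sb) * natR (ℤ.∣ a ∣ ℕ.* ℤ.∣ b ∣)                      ≈⟨ *-cong (signR-* sa sb) (natR-* ℤ.∣ a ∣ ℤ.∣ b ∣) ⟩
    (signR sa * signR sb) * (natR ℤ.∣ a ∣ * natR ℤ.∣ b ∣)                   ≈⟨ *-CS.interchange _ _ _ _ ⟩
    (signR sa * natR ℤ.∣ a ∣) * (signR sb * natR ℤ.∣ b ∣)                   ≈⟨ *-cong (intR≈sign*abs a) (intR≈sign*abs b) ⟨
    intR a * intR b                                                     ∎
    where
    sa = ℤ.sign a
    sb = ℤ.sign b

  intR-homomorphism : ℤ.+-*-rawRing ACR.-Raw-AlmostCommutative⟶ ACR.fromCommutativeRing R
  intR-homomorphism = record
    { ⟦_⟧ = intR ; +-homo = intR-+ ; *-homo = intR-* ; -‿homo = intR-neg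
    ; 0-homo = refl ; 1-homo = +-identityʳ 1# }

  intR-≟ : ∀ a b → Maybe (intR a ≈ intR b)
  intR-≟ a b with a ℤ.≟ b
  ... | yes ≡.refl = just refl
  ... | no _ = nothing

  -- In solver expressions `con (ℤ.+ n)` denotes `natR n`, so `con (ℤ.+ 1)` is `1# + 0#`, not `1#`;
  -- identities that need 1# to be a unit are therefore first rewritten with 1#≈natR1.
  open import Algebra.Solver.Ring ℤ.+-*-rawRing (ACR.fromCommutativeRing R) intR-homomorphism intR-≟ public
    using (solve; _:=_; _:+_; _:*_; _:-_; :-_; con)

  [1+x]-1≈x : ∀ x → (1# + x) - 1# ≈ x
  [1+x]-1≈x x = solve 2 (λ o x → (o :+ x) :- o := x) refl 1# x

  x+1-1≈x : ∀ x → (x + 1#) - 1# ≈ x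
  x+1-1≈x x = solve 2 (λ x o → (x :+ o) :- o := x) refl x 1#

  x-[1+y]≈[x-1]-y : ∀ x y → x - (1# + y) ≈ (x - 1#) - y
  x-[1+y]≈[x-1]-y x y = solve 3 (λ x o y → x :- (o :+ y) := (x :- o) :- y) refl x 1# y

  1#≈natR1 : 1# ≈ natR 1
  1#≈natR1 = sym (+-identityʳ 1#)

  natR-∸ : ∀ {m n} → m ≤ n → natR n - natR m ≈ natR (n ∸ m)
  natR-∸ {m} {n} m≤n = begin
    natR n - natR m                   ≡⟨ ≡.cong (λ t → natR t - natR m) (ℕP.m+[n∸m]≡n m≤n) ⟨
    natR (m +ℕ (n ∸ m)) - natR m      ≈⟨ +-congʳ (natR-+ m (n ∸ m)) ⟩
    (natR m + natR (n ∸ m)) - natR m  ≈⟨ solve 2 (λ x y → (x :+ y) :- x := y) refl (natR m) (natR (n ∸ m)) ⟩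
    natR (n ∸ m)                      ∎

  natR-linear : ∀ a b k → natR (a *ℕ k +ℕ b) ≈ natR a * natR k + natR b
  natR-linear a b k = trans (natR-+ (a *ℕ k) b) (+-congʳ (natR-* a k))

  ·-identityˡ : ∀ x → 1 · x ≈ x
  ·-identityˡ x = trans (*-congʳ (+-identityʳ 1#)) (*-identityˡ x)

  ·-distrib-+ : ∀ m n x → (m +ℕ n) · x ≈ m · x + n · x
  ·-distrib-+ m n x = trans (*-congʳ (natR-+ m n)) (distribʳ _ _ _)

  k>n⇒nCk·x≈0 : ∀ {n k} x → n < k → (n C k) · x ≈ 0#
  k>n⇒nCk·x≈0 x n<k = trans (*-congʳ (reflexive (≡.cong natR (k>n⇒nCk≡0 n<k)))) (zeroˡ x)

  sign-odd : ∀ m → sign (suc (2 *ℕ m)) ≈ - 1#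
  sign-odd m = -‿cong (trans (reflexive (≡.cong sign (≡.cong (m +ℕ_) (ℕP.+-identityʳ m)))) (sign-even m))
    where
    sign-even : ∀ m → sign (m +ℕ m) ≈ 1#
    sign-even zero = refl
    sign-even (suc m) = trans (reflexive (≡.cong (λ t → - sign t) (ℕP.+-suc m m))) (trans (-‿involutive _) (sign-even m))

  sumTo-cong≤ : ∀ n {f g : ℕ → Carrier} → (∀ i → i ≤ n → f i ≈ g i) → sumTo n f ≈ sumTo n g
  sumTo-cong≤ zero f≈g = f≈g 0 z≤n
  sumTo-cong≤ (suc n) f≈g = +-cong (sumTo-cong≤ n (λ i i≤n → f≈g i (ℕP.m≤n⇒m≤1+n i≤n))) (f≈g (suc n) ℕP.≤-refl)

  sumTo-cong : ∀ n {f g : ℕ → Carrier} → (∀ i → f i ≈ g i) → sumTo n f ≈ sumTo n g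
  sumTo-cong n f≈g = sumTo-cong≤ n (λ i _ → f≈g i)

  sumTo-zero : ∀ n {f : ℕ → Carrier} → (∀ i → i ≤ n → f i ≈ 0#) → sumTo n f ≈ 0#
  sumTo-zero zero f≈0 = f≈0 0 z≤n
  sumTo-zero (suc n) f≈0 =
    trans (+-cong (sumTo-zero n (λ i i≤n → f≈0 i (ℕP.m≤n⇒m≤1+n i≤n))) (f≈0 (suc n) ℕP.≤-refl)) (+-identityˡ 0#)

  sumTo-+ : ∀ n (f g : ℕ → Carrier) → sumTo n (λ i → f i + g i) ≈ sumTo n f + sumTo n g
  sumTo-+ zero f g = refl
  sumTo-+ (suc n) f g = trans (+-congʳ (sumTo-+ n f g)) (+-CS.interchange _ _ _ _)

  -‿distrib-sumTo : ∀ n (f : ℕ → Carrier) → - sumTo n f ≈ sumTo n (λ i → - f i)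
  -‿distrib-sumTo zero f = refl
  -‿distrib-sumTo (suc n) f = trans (-‿+-distrib _ _) (+-congʳ (-‿distrib-sumTo n f))

  sumTo-- : ∀ n (f g : ℕ → Carrier) → sumTo n (λ i → f i - g i) ≈ sumTo n f - sumTo n g
  sumTo-- n f g = trans (sumTo-+ n f _) (+-congˡ (sym (-‿distrib-sumTo n g)))

  *-distribˡ-sumTo : ∀ n a (f : ℕ → Carrier) → a * sumTo n f ≈ sumTo n (λ i → a * f i)
  *-distribˡ-sumTo zero a f = refl
  *-distribˡ-sumTo (suc n) a f = trans (distribˡ _ _ _) (+-congʳ (*-distribˡ-sumTo n a f))

  *-distribʳ-sumTo : ∀ n a (f : ℕ → Carrier) → sumTo n f * a ≈ sumTo n (λ i → f i * a)
  *-distribʳ-sumTo n a f = trans (*-comm _ _) (trans (*-distribˡ-sumTo n a f) (sumTo-cong n (λ i → *-comm _ _)))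

  sumTo-head : ∀ n (f : ℕ → Carrier) → sumTo (suc n) f ≈ f 0 + sumTo n (λ i → f (suc i))
  sumTo-head zero f = refl
  sumTo-head (suc n) f = trans (+-congʳ (sumTo-head n f)) (+-assoc _ _ _)

  sumTo-swap : ∀ m n (f : ℕ → ℕ → Carrier) →
    sumTo m (λ i → sumTo n (f i)) ≈ sumTo n (λ j → sumTo m (λ i → f i j))
  sumTo-swap zero n f = refl
  sumTo-swap (suc m) n f = trans (+-congʳ (sumTo-swap m n f)) (sym (sumTo-+ n _ _))

  sumTo-extend : ∀ {m n} {f : ℕ → Carrier} → m ≤ n → (∀ i → m < i → i ≤ n → f i ≈ 0#) → sumTo n f ≈ sumTo m f
  sumTo-extend {n = zero} z≤n _ = refl
  sumTo-extend {m} {suc n} m≤1+n f≈0 with ℕP.m≤n⇒m<n∨m≡n m≤1+n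
  ... | inj₂ ≡.refl = refl
  ... | inj₁ m<1+n = trans (+-cong (sumTo-extend (ℕP.≤-pred m<1+n) (λ i m<i i≤n → f≈0 i m<i (ℕP.m≤n⇒m≤1+n i≤n)))
                                   (f≈0 (suc n) m<1+n ℕP.≤-refl))
                           (+-identityʳ _)

  sumTo-tail : ∀ {k n} {f g : ℕ → Carrier} → k ≤ n → (∀ ν → ν ≤ k → f ν ≈ 0#) → (∀ ν → k < ν → f ν ≈ g ν) →
    sumTo n f ≈ sumTo n g - sumTo k g
  sumTo-tail {k} {n} k≤n f≈0 f≈g with ℕP.m≤n⇒m<n∨m≡n k≤n
  ... | inj₂ ≡.refl = trans (sumTo-zero n f≈0) (sym (-‿inverseʳ _))
  sumTo-tail {k} {suc n} {f} {g} k≤n f≈0 f≈g | inj₁ k<1+n = begin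
    sumTo n f + f (suc n)                    ≈⟨ +-cong (sumTo-tail (ℕP.≤-pred k<1+n) f≈0 f≈g) (f≈g (suc n) k<1+n) ⟩
    (sumTo n g - sumTo k g) + g (suc n)      ≈⟨ solve 3 (λ a b c → (a :- b) :+ c := (a :+ c) :- b) refl (sumTo n g) (sumTo k g) (g (suc n)) ⟩
    sumTo (suc n) g - sumTo k g              ∎

  coeffA : (ℕ → Carrier) → ℕ → ℕ → Carrier
  coeffA α n ν = (n C ν) · α (n ∸ ν)

  Symmetric : (ℕ → Carrier) → Set (c ⊔ ℓ)
  Symmetric α = ∀ m x → A α m (1# - x) ≈ sign m * A α m x

  A≈polyEval : ∀ α n x → A α n x ≈ polyEval n (coeffA α n) x
  A≈polyEval α n x = sumTo-cong n (λ ν → sym (*-assoc _ _ _))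

  polyEval-- : ∀ N (a b : ℕ → Carrier) u → polyEval N (λ k → a k - b k) u ≈ polyEval N a u - polyEval N b u
  polyEval-- N a b u = trans (sumTo-cong N (λ k → solve 3 (λ a b w → (a :- b) :* w := a :* w :- b :* w) refl (a k) (b k) (u ^ k))) (sumTo-- N _ _)

  polyEval-*ˡ : ∀ N s (a : ℕ → Carrier) u → polyEval N (λ k → s * a k) u ≈ s * polyEval N a u
  polyEval-*ˡ N s a u = trans (sumTo-cong N (λ k → *-assoc _ _ _)) (sym (*-distribˡ-sumTo N s _))

  polyEval-suc : ∀ N a x → polyEval (suc N) a x ≈ a 0 + x * polyEval N (λ i → a (suc i)) x
  polyEval-suc N a x = begin
    polyEval (suc N) a x                                   ≈⟨ sumTo-head N _ ⟩
    a 0 * 1# + sumTo N (λ i → a (suc i) * (x * x ^ i))     ≈⟨ +-cong (*-identityʳ _) (sumTo-cong N (λ i → *-CS.x∙yz≈y∙xz _ x _)) ⟩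
    a 0 + sumTo N (λ i → x * (a (suc i) * x ^ i))          ≈⟨ +-congˡ (*-distribˡ-sumTo N x _) ⟨
    a 0 + x * polyEval N (λ i → a (suc i)) x               ∎

  polyEval-divide : ∀ N (a : ℕ → Carrier) c → Σ (ℕ → Carrier) λ b →
    (∀ x → polyEval (suc N) a x ≈ (x - c) * polyEval N b x + polyEval (suc N) a c) × b N ≈ a (suc N)
  polyEval-divide zero a c = (λ _ → a 1) , divides , refl
    where
    divides : ∀ x → polyEval 1 a x ≈ (x - c) * polyEval 0 (λ _ → a 1) x + polyEval 1 a c
    divides x = solve 5 (λ a₀ a₁ x c o → a₀ :* o :+ a₁ :* (x :* o) := (x :- c) :* (a₁ :* o) :+ (a₀ :* o :+ a₁ :* (c :* o))) refl (a 0) (a 1) x c 1#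
  polyEval-divide (suc N) a c with polyEval-divide N (λ i → a (suc i)) c
  ... | b′ , divides′ , leading = b , divides , leading
    where
    r = polyEval (suc N) (λ i → a (suc i)) c
    b : ℕ → Carrier
    b zero = r
    b (suc i) = b′ i
    divides : ∀ x → polyEval (suc (suc N)) a x ≈ (x - c) * polyEval (suc N) b x + polyEval (suc (suc N)) a c
    divides x = begin
      polyEval (suc (suc N)) a x                                 ≈⟨ polyEval-suc (suc N) a x ⟩
      a 0 + x * polyEval (suc N) (λ i → a (suc i)) x             ≈⟨ +-congˡ (*-congˡ (divides′ x)) ⟩
      a 0 + x * ((x - c) * polyEval N b′ x + r)
        ≈⟨ solve 5 (λ a₀ x c q r → a₀ :+ x :* ((x :- c) :* q :+ r) := (x :- c) :* (r :+ x :* q) :+ (a₀ :+ c :* r))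
                   refl (a 0) x c (polyEval N b′ x) r ⟩
      (x - c) * (r + x * polyEval N b′ x) + (a 0 + c * r)       ≈⟨ +-cong (*-congˡ (polyEval-suc N b x)) (polyEval-suc (suc N) a c) ⟨
      (x - c) * polyEval (suc N) b x + polyEval (suc (suc N)) a c ∎

  module _ (cancel : ∀ {x y} → ¬ x ≈ 0# → x * y ≈ 0# → y ≈ 0#) where

    polyEval-zeros⇒coeffs≈0 : ∀ N a (pts : ℕ → Carrier) → (∀ i j → i < j → ¬ pts i ≈ pts j) →
      (∀ j → j ≤ N → polyEval N a (pts j) ≈ 0#) → ∀ i → i ≤ N → a i ≈ 0#
    polyEval-zeros⇒coeffs≈0 zero a pts _ zeros zero z≤n = trans (sym (*-identityʳ _)) (zeros 0 z≤n)
    polyEval-zeros⇒coeffs≈0 (suc N) a pts distinct zeros i i≤1+N with polyEval-divide N a (pts (suc N))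
    ... | b , divides , leading = [ (λ i<1+N → lower i (ℕP.≤-pred i<1+N)) , (λ { ≡.refl → top }) ] (ℕP.m≤n⇒m<n∨m≡n i≤1+N)
      where
      root = pts (suc N)
      quotient-zeros : ∀ j → j ≤ N → polyEval N b (pts j) ≈ 0#
      quotient-zeros j j≤N = cancel (λ pⱼ-c≈0 → distinct j (suc N) (s≤s j≤N) (x∙y⁻¹≈ε⇒x≈y _ _ pⱼ-c≈0)) (begin
        (pts j - root) * polyEval N b (pts j)                             ≈⟨ +-identityʳ _ ⟨
        (pts j - root) * polyEval N b (pts j) + 0#                        ≈⟨ +-congˡ (zeros (suc N) ℕP.≤-refl) ⟨
        (pts j - root) * polyEval N b (pts j) + polyEval (suc N) a root      ≈⟨ divides (pts j) ⟨
        polyEval (suc N) a (pts j)                                     ≈⟨ zeros j (ℕP.m≤n⇒m≤1+n j≤N) ⟩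
        0#                                                             ∎)
      top : a (suc N) ≈ 0#
      top = trans (sym leading) (polyEval-zeros⇒coeffs≈0 N b pts distinct quotient-zeros N ℕP.≤-refl)
      lower : ∀ i → i ≤ N → a i ≈ 0#
      lower = polyEval-zeros⇒coeffs≈0 N a pts distinct λ j j≤N → begin
        polyEval N a (pts j)                              ≈⟨ +-identityʳ _ ⟨
        polyEval N a (pts j) + 0#                         ≈⟨ +-congˡ (trans (*-congʳ top) (zeroˡ _)) ⟨
        polyEval (suc N) a (pts j)                        ≈⟨ zeros j (ℕP.m≤n⇒m≤1+n j≤N) ⟩
        0#                                                ∎

    supported-polyEval-unique : ∀ {d d′} (a b : ℕ → Carrier) (pts : ℕ → Carrier) → (∀ i j → i < j → ¬ pts i ≈ pts j) →
      SupportedBy d a → SupportedBy d′ b → (∀ j → polyEval d a (pts j) ≈ polyEval d′ b (pts j)) → ∀ k → a k ≈ b k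
    supported-polyEval-unique {d} {d′} a b pts distinct a-supp b-supp agree k with k ℕ.≤? d +ℕ d′
    ... | yes k≤D = x∙y⁻¹≈ε⇒x≈y _ _ (polyEval-zeros⇒coeffs≈0 (d +ℕ d′) (λ i → a i - b i) pts distinct zeros k k≤D)
      where
      truncate : ∀ {e} (f : ℕ → Carrier) → e ≤ d +ℕ d′ → SupportedBy e f → ∀ u → polyEval (d +ℕ d′) f u ≈ polyEval e f u
      truncate f e≤D f-supp u = sumTo-extend e≤D (λ i e<i _ → trans (*-congʳ (f-supp i e<i)) (zeroˡ _))
      zeros : ∀ j → j ≤ d +ℕ d′ → polyEval (d +ℕ d′) (λ i → a i - b i) (pts j) ≈ 0#
      zeros j _ = begin
        polyEval (d +ℕ d′) (λ i → a i - b i) (pts j)                    ≈⟨ polyEval-- (d +ℕ d′) a b (pts j) ⟩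
        polyEval (d +ℕ d′) a (pts j) - polyEval (d +ℕ d′) b (pts j)
          ≈⟨ +-cong (truncate a (ℕP.m≤m+n d d′) a-supp _) (-‿cong (truncate b (ℕP.m≤n+m d′ d) b-supp _)) ⟩
        polyEval d a (pts j) - polyEval d′ b (pts j)                      ≈⟨ x≈y⇒x∙y⁻¹≈ε (agree j) ⟩
        0#                                                                ∎
    ... | no k≰D = trans (a-supp k (ℕP.<-≤-trans (s≤s (ℕP.m≤m+n d d′)) k>D)) (sym (b-supp k (ℕP.<-≤-trans (s≤s (ℕP.m≤n+m d′ d)) k>D)))
      where k>D = ℕP.≰⇒> k≰D

  sumTo-pascal : ∀ ν k (w : ℕ → Carrier) →
    sumTo k (λ j → (suc ν C j) · w j) + (ν C k) · w (suc k) ≈ sumTo k (λ j → (ν C j) · (w j + w (suc j)))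
  sumTo-pascal ν zero w = sym (distribˡ _ _ _)
  sumTo-pascal ν (suc k) w = begin
    (S + (suc ν C suc k) · w (suc k)) + Q₂
      ≈⟨ +-congʳ (+-congˡ (trans (*-congʳ (reflexive (≡.cong natR (≡.sym (nCk+nC[k+1]≡[n+1]C[k+1] ν k)))))
                                 (·-distrib-+ (ν C k) (ν C suc k) (w (suc k))))) ⟩
    (S + (P + Q₁)) + Q₂                 ≈⟨ solve 4 (λ s p q t → (s :+ (p :+ q)) :+ t := (s :+ p) :+ (q :+ t)) refl S P Q₁ Q₂ ⟩
    (S + P) + (Q₁ + Q₂)                 ≈⟨ +-cong (sumTo-pascal ν k w) (sym (distribˡ _ _ _)) ⟩
    sumTo (suc k) (λ j → (ν C j) · (w j + w (suc j))) ∎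
    where
    S = sumTo k (λ j → (suc ν C j) · w j)
    P = (ν C k) · w (suc k)
    Q₁ = (ν C suc k) · w (suc k)
    Q₂ = (ν C suc k) · w (suc (suc k))

  binomial : ∀ ν x → (1# - x) ^ ν ≈ sumTo ν (λ j → (ν C j) · (sign j * x ^ j))
  binomial zero x = sym (trans (·-identityˡ _) (*-identityˡ 1#))
  binomial (suc ν) x = begin
    (1# - x) * (1# - x) ^ ν                                  ≈⟨ *-congˡ (binomial ν x) ⟩
    (1# - x) * sumTo ν (λ j → (ν C j) · w j)                 ≈⟨ *-distribˡ-sumTo ν _ _ ⟩
    sumTo ν (λ j → (1# - x) * ((ν C j) · w j))               ≈⟨ sumTo-cong ν (λ j → step (natR (ν C j)) (sign j) (x ^ j)) ⟩
    sumTo ν (λ j → (ν C j) · (w j + w (suc j)))              ≈⟨ +-identityʳ _ ⟨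
    sumTo ν (λ j → (ν C j) · (w j + w (suc j))) + 0#        ≈⟨ +-congˡ (k>n⇒nCk·x≈0 _ (ℕP.n<1+n ν)) ⟨
    sumTo (suc ν) (λ j → (ν C j) · (w j + w (suc j)))        ≈⟨ sumTo-pascal ν (suc ν) w ⟨
    sumTo (suc ν) (λ j → (suc ν C j) · w j) + (ν C suc ν) · w (suc (suc ν))
      ≈⟨ trans (+-congˡ (k>n⇒nCk·x≈0 _ (ℕP.n<1+n ν))) (+-identityʳ _) ⟩
    sumTo (suc ν) (λ j → (suc ν C j) · w j)                  ∎
    where
    w : ℕ → Carrier
    w j = sign j * x ^ j
    step : ∀ c s p → (1# - x) * (c * (s * p)) ≈ c * (s * p + - s * (x * p))
    step c s p = trans (trans (distribʳ _ _ _) (+-congʳ (*-identityˡ _)))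
      (solve 4 (λ x c s p → c :* (s :* p) :+ (:- x) :* (c :* (s :* p)) := c :* (s :* p :+ (:- s) :* (x :* p))) refl x c s p)

  polyEval-reflect : ∀ n (c : ℕ → Carrier) x →
    polyEval n c (1# - x) ≈ polyEval n (λ j → sign j * sumTo n (λ ν → (ν C j) · c ν)) x
  polyEval-reflect n c x = begin
    sumTo n (λ ν → c ν * (1# - x) ^ ν)                                   ≈⟨ sumTo-cong n (λ ν → *-congˡ (binomial ν x)) ⟩
    sumTo n (λ ν → c ν * sumTo ν (λ j → (ν C j) · (sign j * x ^ j)))
      ≈⟨ sumTo-cong≤ n (λ ν ν≤n → *-congˡ (sumTo-extend ν≤n (λ j ν<j _ → k>n⇒nCk·x≈0 _ ν<j))) ⟨
    sumTo n (λ ν → c ν * sumTo n (λ j → (ν C j) · (sign j * x ^ j)))      ≈⟨ sumTo-cong n (λ ν → *-distribˡ-sumTo n (c ν) _) ⟩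
    sumTo n (λ ν → sumTo n (λ j → c ν * ((ν C j) · (sign j * x ^ j))))    ≈⟨ sumTo-swap n n _ ⟩
    sumTo n (λ j → sumTo n (λ ν → c ν * ((ν C j) · (sign j * x ^ j))))
      ≈⟨ sumTo-cong n (λ j → trans (sumTo-cong n (λ ν → regroup (c ν) (natR (ν C j)) (sign j) (x ^ j))) (sym (*-distribʳ-sumTo n (x ^ j) _))) ⟩
    sumTo n (λ j → sumTo n (λ ν → sign j * ((ν C j) · c ν)) * x ^ j)     ≈⟨ sumTo-cong n (λ j → *-congʳ (sym (*-distribˡ-sumTo n (sign j) _))) ⟩
    polyEval n (λ j → sign j * sumTo n (λ ν → (ν C j) · c ν)) x          ∎
    where
    regroup : ∀ c b s p → c * (b * (s * p)) ≈ (s * (b * c)) * p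
    regroup = solve 4 (λ c b s p → c :* (b :* (s :* p)) := (s :* (b :* c)) :* p) refl

  -- Falling factorials

  falling : Carrier → ℕ → Carrier
  falling z zero = 1#
  falling z (suc k) = (z - natR k) * falling z k

  falling-cong : ∀ {z z′} k → z ≈ z′ → falling z k ≈ falling z′ k
  falling-cong zero _ = refl
  falling-cong (suc k) z≈z′ = *-cong (+-congʳ z≈z′) (falling-cong k z≈z′)

  falling-start : ∀ z k → falling z (suc k) ≈ z * falling (z - 1#) k
  falling-start z zero = *-congʳ (trans (+-congˡ -0#≈0#) (+-identityʳ z))
  falling-start z (suc k) = begin
    (z - natR (suc k)) * falling z (suc k)                 ≈⟨ *-congˡ (falling-start z k) ⟩
    (z - (1# + natR k)) * (z * falling (z - 1#) k)
      ≈⟨ solve 4 (λ z o r f → (z :- (o :+ r)) :* (z :* f) := z :* (((z :- o) :- r) :* f)) refl z 1# (natR k) (falling (z - 1#) k) ⟩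
    z * falling (z - 1#) (suc k)                           ∎

  falling-pascal : ∀ z k → falling (1# + z) (suc k) ≈ falling z (suc k) + natR (suc k) * falling z k
  falling-pascal z k = begin
    falling (1# + z) (suc k)                          ≈⟨ falling-start (1# + z) k ⟩
    (1# + z) * falling ((1# + z) - 1#) k              ≈⟨ *-congˡ (falling-cong k ([1+x]-1≈x z)) ⟩
    (1# + z) * falling z k
      ≈⟨ solve 4 (λ o z r f → (o :+ z) :* f := (z :- r) :* f :+ (o :+ r) :* f) refl 1# z (natR k) (falling z k) ⟩
    falling z (suc k) + natR (suc k) * falling z k   ∎

  falling-natR : ∀ a k → falling (natR a) k ≈ natR (k ! *ℕ (a C k))
  falling-natR a zero = sym (+-identityʳ 1#)
  falling-natR zero (suc k) = begin
    falling 0# (suc k)                   ≈⟨ falling-start 0# k ⟩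
    0# * falling (0# - 1#) k             ≈⟨ zeroˡ _ ⟩
    0#                                   ≡⟨ ≡.cong natR (ℕP.*-zeroʳ (suc k !)) ⟨
    natR (suc k ! *ℕ 0)                  ≡⟨ ≡.cong (λ t → natR (suc k ! *ℕ t)) (k>n⇒nCk≡0 {0} {suc k} (s≤s z≤n)) ⟨
    natR (suc k ! *ℕ (0 C suc k))        ∎
  falling-natR (suc a) (suc k) = begin
    falling (1# + natR a) (suc k)                                      ≈⟨ falling-pascal (natR a) k ⟩
    falling (natR a) (suc k) + natR (suc k) * falling (natR a) k      ≈⟨ +-cong (falling-natR a (suc k)) (*-congˡ (falling-natR a k)) ⟩
    natR (suc k ! *ℕ (a C suc k)) + natR (suc k) * natR (k ! *ℕ (a C k))
      ≈⟨ +-congˡ (natR-* (suc k) (k ! *ℕ (a C k))) ⟨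
    natR (suc k ! *ℕ (a C suc k)) + natR (suc k *ℕ (k ! *ℕ (a C k)))  ≈⟨ natR-+ (suc k ! *ℕ (a C suc k)) (suc k *ℕ (k ! *ℕ (a C k))) ⟨
    natR (suc k ! *ℕ (a C suc k) +ℕ suc k *ℕ (k ! *ℕ (a C k)))       ≡⟨ ≡.cong natR (collect (suc k) (k !) (a C suc k) (a C k)) ⟩
    natR (suc k ! *ℕ (a C k +ℕ a C suc k))                             ≡⟨ ≡.cong (λ t → natR (suc k ! *ℕ t)) (nCk+nC[k+1]≡[n+1]C[k+1] a k) ⟩
    natR (suc k ! *ℕ (suc a C suc k))                                  ∎
    where
    collect : ∀ s f x y → s *ℕ f *ℕ x +ℕ s *ℕ (f *ℕ y) ≡ s *ℕ f *ℕ (y +ℕ x)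
    collect = ℕ-Solver.solve-∀

  falling-+ : ∀ z r s → falling z (r +ℕ s) ≈ falling z r * falling (z - natR r) s
  falling-+ z r zero = begin
    falling z (r +ℕ 0)     ≡⟨ ≡.cong (falling z) (ℕP.+-identityʳ r) ⟩
    falling z r            ≈⟨ *-identityʳ _ ⟨
    falling z r * 1#       ∎
  falling-+ z r (suc s) = begin
    falling z (r +ℕ suc s)                                     ≡⟨ ≡.cong (falling z) (ℕP.+-suc r s) ⟩
    (z - natR (r +ℕ s)) * falling z (r +ℕ s)                   ≈⟨ *-cong (+-congˡ (-‿cong (natR-+ r s))) (falling-+ z r s) ⟩
    (z - (natR r + natR s)) * (falling z r * falling (z - natR r) s)
      ≈⟨ solve 5 (λ z r s f g → (z :- (r :+ s)) :* (f :* g) := f :* (((z :- r) :- s) :* g)) refl z (natR r) (natR s) _ _ ⟩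
    falling z r * falling (z - natR r) (suc s)                ∎

  falling-2k-ν : ∀ k ν → ν ≤ k +ℕ k → falling (natR (k +ℕ k) - natR ν) k ≈ natR (k ! *ℕ ((k +ℕ k ∸ ν) C k))
  falling-2k-ν k ν ν≤2k = trans (falling-cong k (natR-∸ ν≤2k)) (falling-natR (k +ℕ k ∸ ν) k)

  falling-k-j*falling-2k-j : ∀ k j → j ≤ k →
    falling (natR k) j * falling (natR (k +ℕ k) - natR j) (k ∸ j) ≈ natR (k ! *ℕ ((k +ℕ k ∸ j) C k))
  falling-k-j*falling-2k-j k j j≤k = begin
    falling (natR k) j * falling (natR (k +ℕ k) - natR j) (k ∸ j)   ≈⟨ *-cong (falling-cong j k≈b-[k-j]) (falling-cong (k ∸ j) (natR-∸ j≤2k)) ⟩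
    falling (natR b - natR (k ∸ j)) j * falling (natR b) (k ∸ j)     ≈⟨ *-comm _ _ ⟩
    falling (natR b) (k ∸ j) * falling (natR b - natR (k ∸ j)) j     ≈⟨ falling-+ (natR b) (k ∸ j) j ⟨
    falling (natR b) (k ∸ j +ℕ j)                                    ≡⟨ ≡.cong (falling (natR b)) (ℕP.m∸n+n≡m j≤k) ⟩
    falling (natR b) k                                               ≈⟨ falling-natR b k ⟩
    natR (k ! *ℕ (b C k))                                            ∎
    where
    b = k +ℕ k ∸ j
    j≤2k = ℕP.≤-trans j≤k (ℕP.m≤m+n k k)
    b≡k+[k-j] : b ≡ k +ℕ (k ∸ j)
    b≡k+[k-j] = ℕP.+-∸-assoc k j≤k
    k≈b-[k-j] : natR k ≈ natR b - natR (k ∸ j)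
    k≈b-[k-j] = begin
      natR k                                   ≡⟨ ≡.cong natR (ℕP.m+n∸n≡m k (k ∸ j)) ⟨
      natR (k +ℕ (k ∸ j) ∸ (k ∸ j))            ≈⟨ natR-∸ (ℕP.m≤n+m (k ∸ j) k) ⟨
      natR (k +ℕ (k ∸ j)) - natR (k ∸ j)       ≡⟨ ≡.cong (λ t → natR t - natR (k ∸ j)) b≡k+[k-j] ⟨
      natR b - natR (k ∸ j)                    ∎

  [2k+2]-[ν+2]≈2k-ν : ∀ k ν → natR (suc k +ℕ suc k) - natR (suc (suc ν)) ≈ natR (k +ℕ k) - natR ν
  [2k+2]-[ν+2]≈2k-ν k ν = begin
    natR (suc (k +ℕ suc k)) - natR (suc (suc ν))   ≡⟨ ≡.cong (λ t → natR (suc t) - natR (suc (suc ν))) (ℕP.+-suc k k) ⟩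
    (1# + (1# + K)) - (1# + (1# + natR ν))         ≈⟨ solve 3 (λ o x y → (o :+ (o :+ x)) :- (o :+ (o :+ y)) := x :- y) refl 1# K (natR ν) ⟩
    K - natR ν                                     ∎
    where K = natR (k +ℕ k)

  [2k+2]-[ν+1]≈2k-ν+1 : ∀ k ν → natR (suc k +ℕ suc k) - natR (suc ν) ≈ (natR (k +ℕ k) - natR ν) + 1#
  [2k+2]-[ν+1]≈2k-ν+1 k ν = begin
    natR (suc (k +ℕ suc k)) - natR (suc ν)         ≡⟨ ≡.cong (λ t → natR (suc t) - natR (suc ν)) (ℕP.+-suc k k) ⟩
    (1# + (1# + K)) - (1# + natR ν)                ≈⟨ solve 3 (λ o x y → (o :+ (o :+ x)) :- (o :+ y) := (x :- y) :+ o) refl 1# K (natR ν) ⟩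
    (K - natR ν) + 1#                              ∎
    where K = natR (k +ℕ k)

  newtonWeight : ℕ → Carrier → ℕ → Carrier
  newtonWeight k a j = sign j * (falling (natR k) j * falling (a - natR j) (k ∸ j))

  newtonWeight-vanishes : ∀ k a → newtonWeight k a (suc k) ≈ 0#
  newtonWeight-vanishes k a =
    trans (*-congˡ (trans (*-congʳ (trans (*-congʳ (-‿inverseʳ (natR k))) (zeroˡ _))) (zeroˡ _))) (zeroʳ _)

  newtonWeight-step< : ∀ k a j → j < k →
    newtonWeight k a j + newtonWeight k a (suc j) ≈ newtonWeight k (a - 1#) j
  newtonWeight-step< k a j j<k = begin
    s * (F * falling (a - natR j) (k ∸ j)) + - s * (((natR k - natR j) * F) * falling (a - natR (suc j)) r)
      ≡⟨ ≡.cong (λ p → s * (F * falling (a - natR j) p) + - s * (((natR k - natR j) * F) * falling (a - natR (suc j)) r))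
                k-j≡1+r ⟩
    s * (F * falling (a - natR j) (suc r)) + - s * (((natR k - natR j) * F) * falling (a - natR (suc j)) r)
      ≈⟨ +-cong (*-congˡ (*-congˡ (trans (falling-start (a - natR j) r) (*-congˡ (falling-cong r a-j-1≈a-1-j)))))
                (*-congˡ (*-cong (*-congʳ gap) (falling-cong r (x-[1+y]≈[x-1]-y a (natR j))))) ⟩
    s * (F * ((a - natR j) * Y)) + - s * ((natR (suc r) * F) * Y)
      ≈⟨ solve 6 (λ s f a j r y → s :* (f :* ((a :- j) :* y)) :+ (:- s) :* ((r :* f) :* y) := s :* (f :* (((a :- j) :- r) :* y)))
               refl s F a (natR j) (natR (suc r)) Y ⟩
    s * (F * (((a - natR j) - natR (suc r)) * Y))
      ≈⟨ *-congˡ (*-congˡ (*-congʳ (solve 4 (λ a j o r → (a :- j) :- (o :+ r) := ((a :- o) :- j) :- r) refl a (natR j) 1# (natR r)))) ⟩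
    s * (F * falling ((a - 1#) - natR j) (suc r))
      ≡⟨ ≡.cong (λ p → s * (F * falling ((a - 1#) - natR j) p)) k-j≡1+r ⟨
    newtonWeight k (a - 1#) j ∎
    where
    r = k ∸ suc j
    k-j≡1+r : k ∸ j ≡ suc r
    k-j≡1+r = ℕP.+-∸-assoc 1 j<k
    s = sign j
    F = falling (natR k) j
    Y = falling ((a - 1#) - natR j) r
    a-j-1≈a-1-j : (a - natR j) - 1# ≈ (a - 1#) - natR j
    a-j-1≈a-1-j = solve 3 (λ a j o → (a :- j) :- o := (a :- o) :- j) refl a (natR j) 1#
    gap : natR k - natR j ≈ natR (suc r)
    gap = trans (natR-∸ (ℕP.<⇒≤ j<k)) (reflexive (≡.cong natR k-j≡1+r))

  newtonWeight-step : ∀ k a j → j ≤ k → newtonWeight k a j + newtonWeight k a (suc j) ≈ newtonWeight k (a - 1#) j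
  newtonWeight-step k a j j≤k with ℕP.m≤n⇒m<n∨m≡n j≤k
  ... | inj₁ j<k = newtonWeight-step< k a j j<k
  ... | inj₂ ≡.refl rewrite ℕP.n∸n≡0 j = trans (+-congˡ (newtonWeight-vanishes j a)) (+-identityʳ _)

  falling-newton : ∀ ν k a → falling (a - natR ν) k ≈ sumTo k (λ j → (ν C j) · newtonWeight k a j)
  falling-newton zero k a = sym (begin
    sumTo k (λ j → (0 C j) · newtonWeight k a j)
      ≈⟨ sumTo-extend {n = k} {f = λ j → (0 C j) · newtonWeight k a j} z≤n (λ j 0<j _ → k>n⇒nCk·x≈0 _ 0<j) ⟩
    1 · (1# * (1# * falling (a - natR 0) k))     ≈⟨ trans (·-identityˡ _) (trans (*-identityˡ _) (*-identityˡ _)) ⟩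
    falling (a - natR 0) k                       ∎)
  falling-newton (suc ν) k a = begin
    falling (a - natR (suc ν)) k                                  ≈⟨ falling-cong k (x-[1+y]≈[x-1]-y a (natR ν)) ⟩
    falling ((a - 1#) - natR ν) k                                 ≈⟨ falling-newton ν k (a - 1#) ⟩
    sumTo k (λ j → (ν C j) · newtonWeight k (a - 1#) j)          ≈⟨ sumTo-cong≤ k (λ j j≤k → *-congˡ (newtonWeight-step k a j j≤k)) ⟨
    sumTo k (λ j → (ν C j) · (w j + w (suc j)))                  ≈⟨ sumTo-pascal ν k w ⟨
    sumTo k (λ j → (suc ν C j) · w j) + (ν C k) · w (suc k)     ≈⟨ +-congˡ (trans (*-congˡ (newtonWeight-vanishes k a)) (zeroʳ _)) ⟩
    sumTo k (λ j → (suc ν C j) · w j) + 0#                      ≈⟨ +-identityʳ _ ⟩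
    sumTo k (λ j → (suc ν C j) · w j)                            ∎
    where
    w = newtonWeight k a

  -- Derivatives of Gₙ,₂ₖ at 1

  derivTerm : Carrier × ℤ → Carrier × ℤ
  derivTerm (a , m) = (intR m * a , m ℤ.- ℤ.+ 1)

  derivTermN : ℕ → Carrier × ℤ → Carrier × ℤ
  derivTermN zero t = t
  derivTermN (suc k) t = derivTerm (derivTermN k t)

  derivN-[] : ∀ k → derivN k [] ≡ []
  derivN-[] zero = ≡.refl
  derivN-[] (suc k) = ≡.cong deriv (derivN-[] k)

  derivN-∷ : ∀ k t ts → derivN k (t ∷ ts) ≡ derivTermN k t ∷ derivN k ts
  derivN-∷ zero t ts = ≡.refl
  derivN-∷ (suc k) t ts = ≡.cong deriv (derivN-∷ k t ts)

  evalAt1-derivN : ∀ k (h : ℕ → Carrier × ℤ) (f : ℕ → ℕ) n →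
    evalAt1 (derivN k (map h (applyUpTo f (suc n)))) ≈ sumTo n (λ ν → proj₁ (derivTermN k (h (f ν))))
  evalAt1-derivN k h f zero = begin
    evalAt1 (derivN k (h (f 0) ∷ []))           ≡⟨ ≡.cong evalAt1 (derivN-∷ k (h (f 0)) []) ⟩
    evalAt1 (derivTermN k (h (f 0)) ∷ derivN k []) ≡⟨ ≡.cong (λ ts → evalAt1 (derivTermN k (h (f 0)) ∷ ts)) (derivN-[] k) ⟩
    proj₁ (derivTermN k (h (f 0))) + 0#          ≈⟨ +-identityʳ _ ⟩
    proj₁ (derivTermN k (h (f 0)))               ∎
  evalAt1-derivN k h f (suc n) = begin
    evalAt1 (derivN k (map h (applyUpTo f (suc (suc n)))))
      ≡⟨ ≡.cong evalAt1 (derivN-∷ k (h (f 0)) _) ⟩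
    proj₁ (derivTermN k (h (f 0))) + evalAt1 (derivN k (map h (applyUpTo (λ ν → f (suc ν)) (suc n))))
      ≈⟨ +-congˡ (evalAt1-derivN k h (λ ν → f (suc ν)) n) ⟩
    proj₁ (derivTermN k (h (f 0))) + sumTo n (λ ν → proj₁ (derivTermN k (h (f (suc ν)))))
      ≈⟨ sumTo-head n _ ⟨
    sumTo (suc n) (λ ν → proj₁ (derivTermN k (h (f ν)))) ∎

  intR-[z-1] : ∀ z → intR (z ℤ.- ℤ.+ 1) ≈ intR z - 1#
  intR-[z-1] z = trans (intR-+ z -[1+ 0 ]) (+-congˡ (-‿cong (+-identityʳ 1#)))

  exponent-derivTermN : ∀ k a e → intR (proj₂ (derivTermN k (a , e))) ≈ intR e - natR k
  exponent-derivTermN zero a e = sym (trans (+-congˡ -0#≈0#) (+-identityʳ _))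
  exponent-derivTermN (suc k) a e = begin
    intR (proj₂ (derivTermN k (a , e)) ℤ.- ℤ.+ 1) ≈⟨ intR-[z-1] (proj₂ (derivTermN k (a , e))) ⟩
    intR (proj₂ (derivTermN k (a , e))) - 1#      ≈⟨ +-congʳ (exponent-derivTermN k a e) ⟩
    (intR e - natR k) - 1#                         ≈⟨ solve 3 (λ x y o → (x :- y) :- o := x :- (o :+ y)) refl (intR e) (natR k) 1# ⟩
    intR e - natR (suc k)                          ∎

  coefficient-derivTermN : ∀ k a e → proj₁ (derivTermN k (a , e)) ≈ falling (intR e) k * a
  coefficient-derivTermN zero a e = sym (*-identityˡ a)
  coefficient-derivTermN (suc k) a e = begin
    intR (proj₂ (derivTermN k (a , e))) * proj₁ (derivTermN k (a , e))
      ≈⟨ *-cong (exponent-derivTermN k a e) (coefficient-derivTermN k a e) ⟩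
    (intR e - natR k) * (falling (intR e) k * a)
      ≈⟨ *-assoc _ _ _ ⟨
    falling (intR e) (suc k) * a ∎

  ω≈sumTo-falling : ∀ α n k → ω α n k ≈ sumTo n (λ ν → falling (natR (k +ℕ k) - natR ν) k * coeffA α n ν)
  ω≈sumTo-falling α n k = trans (evalAt1-derivN k _ (λ ν → ν) n) (sumTo-cong n λ ν →
    trans (coefficient-derivTermN k _ _) (*-congʳ (falling-cong k (trans (intR-+ (ℤ.+ (k +ℕ k)) (ℤ.- ℤ.+ ν)) (+-congˡ (intR-neg (ℤ.+ ν)))))))

  ω≈sumTo-newton : ∀ α n k → ω α n k ≈ sumTo k (λ j → newtonWeight k (natR (k +ℕ k)) j * sumTo n (λ ν → (ν C j) · coeffA α n ν))
  ω≈sumTo-newton α n k = begin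
    ω α n k                                                     ≈⟨ ω≈sumTo-falling α n k ⟩
    sumTo n (λ ν → falling (a - natR ν) k * coeffA α n ν)
      ≈⟨ sumTo-cong n (λ ν → trans (*-congʳ (falling-newton ν k a)) (*-distribʳ-sumTo k _ _)) ⟩
    sumTo n (λ ν → sumTo k (λ j → ((ν C j) · w j) * coeffA α n ν)) ≈⟨ sumTo-swap n k _ ⟩
    sumTo k (λ j → sumTo n (λ ν → ((ν C j) · w j) * coeffA α n ν))
      ≈⟨ sumTo-cong k (λ j → trans (sumTo-cong n (λ ν → regroup (natR (ν C j)) (w j) (coeffA α n ν))) (sym (*-distribˡ-sumTo n (w j) _))) ⟩
    sumTo k (λ j → w j * sumTo n (λ ν → (ν C j) · coeffA α n ν))   ∎
    where
    a = natR (k +ℕ k)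
    w = newtonWeight k a
    regroup : ∀ b w c → (b * w) * c ≈ w * (b * c)
    regroup = solve 3 (λ b w c → (b :* w) :* c := w :* (b :* c)) refl

  -- With z = (2k+2) - v, this is (z+2)(z+1) z^{(k)} = ((4k+6)(z-k) + v(v-1)) z^{(k)}.
  falling-recurrence : ∀ k v →
    falling (natR (suc (suc k) +ℕ suc (suc k)) - v) (suc (suc k))
      ≈ natR (4 *ℕ k +ℕ 6) * falling (natR (suc k +ℕ suc k) - v) (suc k)
        + (v * (v - 1#)) * falling (natR (suc k +ℕ suc k) - v) k
  falling-recurrence k v = begin
    falling (X₂ - v) (suc (suc k))
      ≈⟨ trans (falling-start _ (suc k)) (*-congˡ (falling-start _ k)) ⟩
    (X₂ - v) * (((X₂ - v) - 1#) * falling (((X₂ - v) - 1#) - 1#) k)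
      ≈⟨ trans (sym (*-assoc _ _ _)) (*-cong scalar (falling-cong k shift)) ⟩
    (natR (4 *ℕ k +ℕ 6) * ((X₁ - v) - K) + v * (v - 1#)) * F
      ≈⟨ solve 4 (λ a b c f → (a :* b :+ c) :* f := a :* (b :* f) :+ c :* f) refl (natR (4 *ℕ k +ℕ 6)) ((X₁ - v) - K) (v * (v - 1#)) F ⟩
    natR (4 *ℕ k +ℕ 6) * falling (X₁ - v) (suc k) + (v * (v - 1#)) * F ∎
    where
    K = natR k
    X₁ = natR (suc k +ℕ suc k)
    X₂ = natR (suc (suc k) +ℕ suc (suc k))
    F = falling (X₁ - v) k
    X₁≈ : X₁ ≈ natR 2 * K + natR 2
    X₁≈ = trans (reflexive (≡.cong natR (double k))) (natR-linear 2 2 k)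
      where
      double : ∀ k → suc k +ℕ suc k ≡ 2 *ℕ k +ℕ 2
      double = ℕ-Solver.solve-∀
    X₂≈ : X₂ ≈ natR 2 * K + natR 4
    X₂≈ = trans (reflexive (≡.cong natR (double k))) (natR-linear 2 4 k)
      where
      double : ∀ k → suc (suc k) +ℕ suc (suc k) ≡ 2 *ℕ k +ℕ 4
      double = ℕ-Solver.solve-∀
    shift : ((X₂ - v) - 1#) - 1# ≈ X₁ - v
    shift = begin
      ((X₂ - v) - 1#) - 1#                                ≈⟨ +-cong (+-cong (+-congʳ X₂≈) (-‿cong 1#≈natR1)) (-‿cong 1#≈natR1) ⟩
      (((natR 2 * K + natR 4) - v) - natR 1) - natR 1
        ≈⟨ solve 2 (λ K v → (((con (ℤ.+ 2) :* K :+ con (ℤ.+ 4)) :- v) :- con (ℤ.+ 1)) :- con (ℤ.+ 1)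
                            := (con (ℤ.+ 2) :* K :+ con (ℤ.+ 2)) :- v) refl K v ⟩
      (natR 2 * K + natR 2) - v                           ≈⟨ +-congʳ X₁≈ ⟨
      X₁ - v                                              ∎
    scalar : (X₂ - v) * ((X₂ - v) - 1#) ≈ natR (4 *ℕ k +ℕ 6) * ((X₁ - v) - K) + v * (v - 1#)
    scalar = begin
      (X₂ - v) * ((X₂ - v) - 1#)
        ≈⟨ *-cong (+-congʳ X₂≈) (+-cong (+-congʳ X₂≈) (-‿cong 1#≈natR1)) ⟩
      ((natR 2 * K + natR 4) - v) * (((natR 2 * K + natR 4) - v) - natR 1)
        ≈⟨ solve 2 (λ K v → ((con (ℤ.+ 2) :* K :+ con (ℤ.+ 4)) :- v) :* (((con (ℤ.+ 2) :* K :+ con (ℤ.+ 4)) :- v) :- con (ℤ.+ 1))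
                   := (con (ℤ.+ 4) :* K :+ con (ℤ.+ 6)) :* (((con (ℤ.+ 2) :* K :+ con (ℤ.+ 2)) :- v) :- K) :+ v :* (v :- con (ℤ.+ 1))) refl K v ⟩
      (natR 4 * K + natR 6) * (((natR 2 * K + natR 2) - v) - K) + v * (v - natR 1)
        ≈⟨ +-cong (*-cong (natR-linear 4 6 k) (+-congʳ (+-congʳ X₁≈))) (*-congˡ (+-congˡ (-‿cong 1#≈natR1))) ⟨
      natR (4 *ℕ k +ℕ 6) * ((X₁ - v) - K) + v * (v - 1#) ∎

  sumTo-ν[ν-1]-coeffA : ∀ α m (f : ℕ → Carrier) →
    sumTo (suc (suc m)) (λ ν → ((natR ν * (natR ν - 1#)) * f ν) * coeffA α (suc (suc m)) ν)
      ≈ natR (suc (suc m) *ℕ suc m) * sumTo m (λ μ → f (suc (suc μ)) * coeffA α m μ)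
  sumTo-ν[ν-1]-coeffA α m f = begin
    sumTo (suc (suc m)) h                                    ≈⟨ trans (sumTo-head (suc m) h) (+-congˡ (sumTo-head m _)) ⟩
    h 0 + (h 1 + sumTo m (λ μ → h (suc (suc μ))))            ≈⟨ +-cong h0 (+-cong h1 (sumTo-cong m term)) ⟩
    0# + (0# + sumTo m (λ μ → B * (f (suc (suc μ)) * coeffA α m μ)))
      ≈⟨ trans (+-identityˡ _) (trans (+-identityˡ _) (sym (*-distribˡ-sumTo m B _))) ⟩
    B * sumTo m (λ μ → f (suc (suc μ)) * coeffA α m μ)       ∎
    where
    h : ℕ → Carrier
    h ν = ((natR ν * (natR ν - 1#)) * f ν) * coeffA α (suc (suc m)) ν
    B = natR (suc (suc m) *ℕ suc m)
    h0 : h 0 ≈ 0#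
    h0 = trans (*-congʳ (trans (*-congʳ (zeroˡ _)) (zeroˡ _))) (zeroˡ _)
    h1 : h 1 ≈ 0#
    h1 = trans (*-congʳ (trans (*-congʳ (trans (*-congˡ ([1+x]-1≈x 0#)) (zeroʳ _))) (zeroˡ _))) (zeroˡ _)
    term : ∀ μ → h (suc (suc μ)) ≈ B * (f (suc (suc μ)) * coeffA α m μ)
    term μ = begin
      ((v * (v - 1#)) * F) * (natR (suc (suc m) C suc (suc μ)) * a)
        ≈⟨ *-congʳ (*-congʳ (*-congˡ ([1+x]-1≈x (natR (suc μ))))) ⟩
      ((v * natR (suc μ)) * F) * (natR (suc (suc m) C suc (suc μ)) * a)
        ≈⟨ solve 5 (λ v u f c a → ((v :* u) :* f) :* (c :* a) := ((v :* u) :* c) :* (f :* a)) refl v (natR (suc μ)) F _ a ⟩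
      ((v * natR (suc μ)) * natR (suc (suc m) C suc (suc μ))) * (F * a)
        ≈⟨ *-congʳ (trans (natR-* (suc (suc μ) *ℕ suc μ) (suc (suc m) C suc (suc μ))) (*-congʳ (natR-* (suc (suc μ)) (suc μ)))) ⟨
      natR (suc (suc μ) *ℕ suc μ *ℕ (suc (suc m) C suc (suc μ))) * (F * a)
        ≡⟨ ≡.cong (λ t → natR t * (F * a)) ([2+k][1+k]*[2+n]C[2+k]≡[2+n][1+n]*nCk m μ) ⟩
      natR (suc (suc m) *ℕ suc m *ℕ (m C μ)) * (F * a)
        ≈⟨ *-congʳ (natR-* (suc (suc m) *ℕ suc m) (m C μ)) ⟩
      (B * natR (m C μ)) * (F * a)
        ≈⟨ solve 4 (λ b c f a → (b :* c) :* (f :* a) := b :* (f :* (c :* a))) refl B (natR (m C μ)) F a ⟩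
      B * (F * coeffA α m μ)   ∎
      where
      v = natR (suc (suc μ))
      F = f (suc (suc μ))
      a = α (m ∸ μ)

  ω-recurrence : ∀ α n k → 2 ≤ n →
    ω α n (k +ℕ 2) ≈ (4 *ℕ k +ℕ 6) · ω α n (k +ℕ 1) + (n *ℕ (n ∸ 1)) · ω α (n ∸ 2) k
  ω-recurrence α (suc zero) k (s≤s ())
  ω-recurrence α (suc (suc m)) k _ rewrite ℕP.+-comm k 2 | ℕP.+-comm k 1 = begin
    ω α n (suc (suc k))
      ≈⟨ ω≈sumTo-falling α n (suc (suc k)) ⟩
    sumTo n (λ ν → falling (X₂ - natR ν) (suc (suc k)) * coeffA α n ν)
      ≈⟨ sumTo-cong n (λ ν → trans (*-congʳ (falling-recurrence k (natR ν))) (distribʳ _ _ _)) ⟩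
    sumTo n (λ ν → (a * f₁ ν) * coeffA α n ν + ((natR ν * (natR ν - 1#)) * f₀ ν) * coeffA α n ν)
      ≈⟨ sumTo-+ n _ _ ⟩
    sumTo n (λ ν → (a * f₁ ν) * coeffA α n ν) + sumTo n (λ ν → ((natR ν * (natR ν - 1#)) * f₀ ν) * coeffA α n ν)
      ≈⟨ +-cong (trans (sumTo-cong n (λ ν → *-assoc _ _ _)) (sym (*-distribˡ-sumTo n a _))) (sumTo-ν[ν-1]-coeffA α m f₀) ⟩
    a * sumTo n (λ ν → f₁ ν * coeffA α n ν) + B * sumTo m (λ μ → f₀ (suc (suc μ)) * coeffA α m μ)
      ≈⟨ +-cong (*-congˡ (sym (ω≈sumTo-falling α n (suc k))))
                (*-congˡ (trans (sumTo-cong m (λ μ → *-congʳ (falling-cong k ([2k+2]-[ν+2]≈2k-ν k μ)))) (sym (ω≈sumTo-falling α m k)))) ⟩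
    a * ω α n (suc k) + B * ω α m k ∎
    where
    n = suc (suc m)
    a = natR (4 *ℕ k +ℕ 6)
    B = natR (suc (suc m) *ℕ suc m)
    X₁ = natR (suc k +ℕ suc k)
    X₂ = natR (suc (suc k) +ℕ suc (suc k))
    f₁ f₀ : ℕ → Carrier
    f₁ ν = falling (X₁ - natR ν) (suc k)
    f₀ ν = falling (X₁ - natR ν) k

  -- Fibonacci polynomials

  fibPoly : ℕ → ℕ → Carrier → Carrier
  fibPoly M ν u = sumTo M (λ k → fibCoeff ν k · (u ^ k))

  fibPoly-step : ∀ M ν u → ν ≤ M +ℕ M → fibPoly M (suc (suc ν)) u ≈ fibPoly M (suc ν) u + u * fibPoly M ν u
  fibPoly-step zero zero u z≤n = sym (trans (+-congˡ (trans (*-congˡ (zeroˡ _)) (zeroʳ _))) (+-identityʳ _))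
  fibPoly-step (suc M) ν u ν≤2M+2 = begin
    fibPoly (suc M) (suc (suc ν)) u
      ≈⟨ sumTo-head M _ ⟩
    fibCoeff (suc ν) 0 · 1# + sumTo M (λ k → (fibCoeff (suc ν) (suc k) +ℕ fibCoeff ν k) · (u * u ^ k))
      ≈⟨ +-congˡ (trans (sumTo-cong M (λ k → ·-distrib-+ (fibCoeff (suc ν) (suc k)) (fibCoeff ν k) _)) (sumTo-+ M _ _)) ⟩
    fibCoeff (suc ν) 0 · 1# + (sumTo M (λ k → fibCoeff (suc ν) (suc k) · (u * u ^ k)) + sumTo M (λ k → fibCoeff ν k · (u * u ^ k)))
      ≈⟨ +-assoc _ _ _ ⟨
    (fibCoeff (suc ν) 0 · 1# + sumTo M (λ k → fibCoeff (suc ν) (suc k) · (u * u ^ k))) + sumTo M (λ k → fibCoeff ν k · (u * u ^ k))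
      ≈⟨ +-cong (sym (sumTo-head M _)) (trans (sumTo-cong M (λ k → *-CS.x∙yz≈y∙xz _ u _)) (sym (*-distribˡ-sumTo M u _))) ⟩
    fibPoly (suc M) (suc ν) u + u * fibPoly M ν u
      ≈⟨ +-congˡ (*-congˡ (trans (+-congˡ (top-term≈0)) (+-identityʳ _))) ⟨
    fibPoly (suc M) (suc ν) u + u * fibPoly (suc M) ν u ∎
    where
    top-term≈0 : fibCoeff ν (suc M) · (u ^ suc M) ≈ 0#
    top-term≈0 = trans (*-congʳ (reflexive (≡.cong natR (fibCoeff-vanishes ν (suc M) ν≤2M+2)))) (zeroˡ _)

  xᵛ-[1-x]ᵛ≈fibPoly : ∀ M ν x → ν ≤ suc (M +ℕ M) →
    x ^ ν - (1# - x) ^ ν ≈ (2 · x - 1#) * fibPoly M ν (x * (x - 1#))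
  xᵛ-[1-x]ᵛ≈fibPoly M zero x _ = trans (-‿inverseʳ 1#) (sym (trans (*-congˡ (sumTo-zero M (λ k _ → zeroˡ _))) (zeroʳ _)))
  xᵛ-[1-x]ᵛ≈fibPoly M (suc zero) x _ = begin
    x * 1# - (1# - x) * 1#           ≈⟨ +-cong (*-identityʳ x) (-‿cong (trans (*-identityʳ _) (+-congʳ 1#≈natR1))) ⟩
    x - (natR 1 - x)                 ≈⟨ solve 1 (λ x → x :- (con (ℤ.+ 1) :- x) := con (ℤ.+ 2) :* x :- con (ℤ.+ 1)) refl x ⟩
    2 · x - natR 1                   ≈⟨ +-congˡ (-‿cong 1#≈natR1) ⟨
    2 · x - 1#                       ≈⟨ *-identityʳ _ ⟨
    (2 · x - 1#) * 1#
      ≈⟨ *-congˡ (trans (sumTo-extend {n = M} {f = λ k → fibCoeff 1 k · (u ^ k)} z≤n (λ { (suc i) _ _ → zeroˡ _ })) (·-identityˡ 1#)) ⟨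
    (2 · x - 1#) * fibPoly M 1 u     ∎
    where u = x * (x - 1#)
  xᵛ-[1-x]ᵛ≈fibPoly M (suc (suc ν)) x ν≤2M+1 = begin
    x * (x * x ^ ν) - (1# - x) * ((1# - x) * (1# - x) ^ ν)
      ≈⟨ +-congˡ (-‿cong (*-cong o≈ (*-congʳ o≈))) ⟩
    x * (x * p) - (natR 1 - x) * ((natR 1 - x) * q)
      ≈⟨ solve 3 (λ x p q → x :* (x :* p) :- (con (ℤ.+ 1) :- x) :* ((con (ℤ.+ 1) :- x) :* q)
                   := (x :* p :- (con (ℤ.+ 1) :- x) :* q) :+ (x :* (x :- con (ℤ.+ 1))) :* (p :- q)) refl x p q ⟩
    (x * p - (natR 1 - x) * q) + (x * (x - natR 1)) * (p - q)
      ≈⟨ sym (+-cong (+-congˡ (-‿cong (*-congʳ o≈))) (*-congʳ (*-congˡ (+-congˡ (-‿cong 1#≈natR1))))) ⟩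
    (x * x ^ ν - (1# - x) * (1# - x) ^ ν) + u * (x ^ ν - (1# - x) ^ ν)
      ≈⟨ +-cong (xᵛ-[1-x]ᵛ≈fibPoly M (suc ν) x 1+ν≤2M+1)
                (*-congˡ (xᵛ-[1-x]ᵛ≈fibPoly M ν x (ℕP.≤-trans (ℕP.n≤1+n ν) 1+ν≤2M+1))) ⟩
    t * fibPoly M (suc ν) u + u * (t * fibPoly M ν u)
      ≈⟨ solve 4 (λ t a u b → t :* a :+ u :* (t :* b) := t :* (a :+ u :* b)) refl t (fibPoly M (suc ν) u) u (fibPoly M ν u) ⟩
    t * (fibPoly M (suc ν) u + u * fibPoly M ν u)
      ≈⟨ *-congˡ (fibPoly-step M ν u (ℕP.≤-pred 1+ν≤2M+1)) ⟨
    t * fibPoly M (suc (suc ν)) u ∎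
    where
    u = x * (x - 1#)
    t = 2 · x - 1#
    p = x ^ ν
    q = (1# - x) ^ ν
    o≈ : 1# - x ≈ natR 1 - x
    o≈ = +-congʳ 1#≈natR1
    1+ν≤2M+1 : suc ν ≤ suc (M +ℕ M)
    1+ν≤2M+1 = ℕP.≤-trans (ℕP.n≤1+n (suc ν)) ν≤2M+1

  A-A[1-x]≈fibPoly : ∀ α n M x → n ≤ suc (M +ℕ M) →
    A α n x - A α n (1# - x) ≈ (2 · x - 1#) * polyEval M (λ k → sumTo n (λ ν → fibCoeff ν k · coeffA α n ν)) (x * (x - 1#))
  A-A[1-x]≈fibPoly α n M x n≤2M+1 = begin
    A α n x - A α n (1# - x)
      ≈⟨ +-cong (A≈polyEval α n x) (-‿cong (A≈polyEval α n (1# - x))) ⟩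
    polyEval n γ x - polyEval n γ (1# - x)
      ≈⟨ sumTo-- n _ _ ⟨
    sumTo n (λ ν → γ ν * x ^ ν - γ ν * (1# - x) ^ ν)
      ≈⟨ sumTo-cong≤ n (λ ν ν≤n → trans (solve 3 (λ c p q → c :* p :- c :* q := c :* (p :- q)) refl (γ ν) (x ^ ν) ((1# - x) ^ ν))
                                        (*-congˡ (xᵛ-[1-x]ᵛ≈fibPoly M ν x (ℕP.≤-trans ν≤n n≤2M+1)))) ⟩
    sumTo n (λ ν → γ ν * (t * fibPoly M ν u))
      ≈⟨ sumTo-cong n (λ ν → trans (*-CS.x∙yz≈y∙xz (γ ν) t _) (*-congˡ (*-distribˡ-sumTo M (γ ν) _))) ⟩
    sumTo n (λ ν → t * sumTo M (λ k → γ ν * (fibCoeff ν k · u ^ k)))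
      ≈⟨ trans (sym (*-distribˡ-sumTo n t _)) (*-congˡ (sumTo-swap n M _)) ⟩
    t * sumTo M (λ k → sumTo n (λ ν → γ ν * (fibCoeff ν k · u ^ k)))
      ≈⟨ *-congˡ (sumTo-cong M (λ k → trans (sumTo-cong n (λ ν → regroup (γ ν) (natR (fibCoeff ν k)) (u ^ k)))
                                            (sym (*-distribʳ-sumTo n (u ^ k) _)))) ⟩
    t * polyEval M (λ k → sumTo n (λ ν → fibCoeff ν k · γ ν)) u ∎
    where
    γ = coeffA α n
    t = 2 · x - 1#
    u = x * (x - 1#)
    regroup : ∀ c l w → c * (l * w) ≈ (l * c) * w
    regroup = solve 3 (λ c l w → c :* (l :* w) := (l :* c) :* w) refl

  fibCoeff-falling-diagonal : ∀ k →
    natR (suc k !) * natR (fibCoeff (suc (suc k)) (suc k)) ≈ sign (suc k) * falling (natR (suc k +ℕ suc k) - natR (suc (suc k))) (suc k)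
  fibCoeff-falling-diagonal k = begin
    natR (suc k !) * natR (fibCoeff (suc k) (suc k) +ℕ fibCoeff k k)
      ≡⟨ ≡.cong (λ t → natR (suc k !) * natR t) (≡.cong₂ _+ℕ_ (fibCoeff-vanishes (suc k) (suc k) (ℕP.m≤n+m (suc k) (suc k)))
                                                              (fibCoeff-vanishes k k (ℕP.m≤n+m k k))) ⟩
    natR (suc k !) * 0#                                     ≈⟨ zeroʳ _ ⟩
    0#                                                      ≈⟨ trans (*-congˡ (trans (*-congʳ z-k≈0) (zeroˡ _))) (zeroʳ _) ⟨
    sign (suc k) * ((z - natR k) * falling z k)             ∎
    where
    z = natR (suc k +ℕ suc k) - natR (suc (suc k))
    z-k≈0 : z - natR k ≈ 0#
    z-k≈0 = begin
      z - natR k                            ≈⟨ +-congʳ ([2k+2]-[ν+2]≈2k-ν k k) ⟩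
      (natR (k +ℕ k) - natR k) - natR k     ≈⟨ +-congʳ (+-congʳ (natR-+ k k)) ⟩
      ((natR k + natR k) - natR k) - natR k ≈⟨ solve 1 (λ x → ((x :+ x) :- x) :- x := con (ℤ.+ 0)) refl (natR k) ⟩
      0#                                    ∎

  fibCoeff-falling-step : ∀ ν k →
    natR (suc k !) * natR (fibCoeff (suc ν) (suc k)) ≈ sign (suc k) * falling (natR (suc k +ℕ suc k) - natR (suc ν)) (suc k) →
    natR (k !) * natR (fibCoeff ν k) ≈ sign k * falling (natR (k +ℕ k) - natR ν) k →
    natR (suc k !) * natR (fibCoeff (suc (suc ν)) (suc k)) ≈ sign (suc k) * falling (natR (suc k +ℕ suc k) - natR (suc (suc ν))) (suc k)
  fibCoeff-falling-step ν k IH₁ IH₀ = begin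
    natR (suc k !) * natR (ℓ₁ +ℕ ℓ₀)
      ≈⟨ *-cong (natR-* (suc k) (k !)) (natR-+ ℓ₁ ℓ₀) ⟩
    (natR (suc k) * natR (k !)) * (natR ℓ₁ + natR ℓ₀)
      ≈⟨ solve 4 (λ a f l₁ l₀ → (a :* f) :* (l₁ :+ l₀) := (a :* f) :* l₁ :+ a :* (f :* l₀))
                 refl (natR (suc k)) (natR (k !)) (natR ℓ₁) (natR ℓ₀) ⟩
    (natR (suc k) * natR (k !)) * natR ℓ₁ + natR (suc k) * (natR (k !) * natR ℓ₀)
      ≈⟨ +-cong (trans (*-congʳ (sym (natR-* (suc k) (k !)))) IH₁) (*-congˡ IH₀) ⟩
    sign (suc k) * falling (natR (suc k +ℕ suc k) - natR (suc ν)) (suc k) + natR (suc k) * (sign k * F)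
      ≈⟨ +-congʳ (*-congˡ (trans (falling-cong (suc k) ([2k+2]-[ν+1]≈2k-ν+1 k ν))
                                 (trans (falling-start (B + 1#) k) (*-congˡ (falling-cong k (x+1-1≈x B)))))) ⟩
    - sign k * ((B + 1#) * F) + (1# + natR k) * (sign k * F)
      ≈⟨ solve 5 (λ s b o x f → (:- s) :* ((b :+ o) :* f) :+ (o :+ x) :* (s :* f) := (:- s) :* ((b :- x) :* f)) refl (sign k) B 1# (natR k) F ⟩
    sign (suc k) * falling B (suc k)
      ≈⟨ *-congˡ (falling-cong (suc k) ([2k+2]-[ν+2]≈2k-ν k ν)) ⟨
    sign (suc k) * falling (natR (suc k +ℕ suc k) - natR (suc (suc ν))) (suc k) ∎
    where
    ℓ₁ = fibCoeff (suc ν) (suc k)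
    ℓ₀ = fibCoeff ν k
    B = natR (k +ℕ k) - natR ν
    F = falling B k

  fibCoeff-falling : ∀ ν k → k < ν → natR (k !) * natR (fibCoeff ν k) ≈ sign k * falling (natR (k +ℕ k) - natR ν) k
  fibCoeff-falling (suc ν) zero _ rewrite fibCoeff-[1+ν]-0 ν = *-cong (sym 1#≈natR1) (sym 1#≈natR1)
  fibCoeff-falling (suc zero) (suc k) (s≤s ())
  fibCoeff-falling (suc (suc ν)) (suc k) (s≤s (s≤s k≤ν)) = [_,_]
    (λ k<ν → fibCoeff-falling-step ν k (fibCoeff-falling (suc ν) (suc k) (s≤s k<ν)) (fibCoeff-falling ν k k<ν))
    (λ { ≡.refl → fibCoeff-falling-diagonal k })
    (ℕP.m≤n⇒m<n∨m≡n k≤ν)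

module CharZero {c ℓ} (K : CharZeroField c ℓ) where
  open CharZeroField K using (inverse; charZero)
  R = CharZeroField.ring K
  open CommutativeRing R
  open Poly R
  open Identities R
  open import Algebra.Properties.AbelianGroup +-abelianGroup using (x∙y⁻¹≈ε⇒x≈y)
  open import Algebra.Properties.Ring ring using (-1*x≈-x; -‿involutive)
  open import Algebra.Properties.CommutativeSemigroup *-commutativeSemigroup using (x∙yz≈y∙xz)
  open import Relation.Binary.Reasoning.Setoid setoid

  cancel : ∀ {x y} → ¬ x ≈ 0# → x * y ≈ 0# → y ≈ 0#
  cancel {x} {y} x≉0 xy≈0 with inverse x x≉0
  ... | x⁻¹ , xx⁻¹≈1 = begin
    y                 ≈⟨ *-identityˡ y ⟨
    1# * y            ≈⟨ *-congʳ xx⁻¹≈1 ⟨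
    (x * x⁻¹) * y     ≈⟨ solve 3 (λ x x⁻¹ y → (x :* x⁻¹) :* y := x⁻¹ :* (x :* y)) refl x x⁻¹ y ⟩
    x⁻¹ * (x * y)     ≈⟨ *-congˡ xy≈0 ⟩
    x⁻¹ * 0#          ≈⟨ zeroʳ x⁻¹ ⟩
    0#                ∎

  *-cancelˡ : ∀ {x y z} → ¬ x ≈ 0# → x * y ≈ x * z → y ≈ z
  *-cancelˡ {x} {y} {z} x≉0 xy≈xz = x∙y⁻¹≈ε⇒x≈y y z (cancel x≉0 (begin
    x * (y - z)        ≈⟨ solve 3 (λ x y z → x :* (y :- z) := x :* y :- x :* z) refl x y z ⟩
    x * y - x * z      ≈⟨ +-congʳ xy≈xz ⟩
    x * z - x * z      ≈⟨ -‿inverseʳ _ ⟩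
    0#                 ∎))

  natR-<⇒≉ : ∀ {m n} → m < n → ¬ natR m ≈ natR n
  natR-<⇒≉ {m} {n} m<n m≈n = charZero (n ∸ suc m) (begin
    natR (suc (n ∸ suc m))     ≡⟨ ≡.cong natR (ℕP.+-∸-assoc 1 m<n) ⟨
    natR (n ∸ m)               ≈⟨ natR-∸ (ℕP.<⇒≤ m<n) ⟨
    natR n - natR m            ≈⟨ +-congʳ m≈n ⟨
    natR m - natR m            ≈⟨ -‿inverseʳ _ ⟩
    0#                         ∎)

  ½ : Carrier
  ½ = proj₁ (inverse (natR 2) (charZero 1))

  ½*2x≈x : ∀ x → ½ * (natR 2 * x) ≈ x
  ½*2x≈x x = begin
    ½ * (natR 2 * x)      ≈⟨ *-assoc _ _ _ ⟨
    (½ * natR 2) * x      ≈⟨ *-congʳ (trans (*-comm _ _) (proj₂ (inverse (natR 2) (charZero 1)))) ⟩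
    1# * x                ≈⟨ *-identityˡ x ⟩
    x                     ∎

  symmetric-coeffA : ∀ α → Symmetric α → ∀ n j → j ≤ n →
    sign j * sumTo n (λ ν → (ν C j) · coeffA α n ν) ≈ sign n * coeffA α n j
  symmetric-coeffA α α-sym n j j≤n =
    x∙y⁻¹≈ε⇒x≈y _ _ (polyEval-zeros⇒coeffs≈0 cancel n _ natR (λ _ _ → natR-<⇒≉) (λ i _ → zeros (natR i)) j j≤n)
    where
    γ = coeffA α n
    zeros : ∀ x → polyEval n (λ j → sign j * sumTo n (λ ν → (ν C j) · γ ν) - sign n * γ j) x ≈ 0#
    zeros x = begin
      polyEval n (λ j → sign j * sumTo n (λ ν → (ν C j) · γ ν) - sign n * γ j) x
        ≈⟨ polyEval-- n _ _ x ⟩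
      polyEval n (λ j → sign j * sumTo n (λ ν → (ν C j) · γ ν)) x - polyEval n (λ j → sign n * γ j) x
        ≈⟨ +-cong (sym (polyEval-reflect n γ x)) (-‿cong (polyEval-*ˡ n (sign n) γ x)) ⟩
      polyEval n γ (1# - x) - sign n * polyEval n γ x
        ≈⟨ +-cong (sym (A≈polyEval α n (1# - x))) (-‿cong (*-congˡ (sym (A≈polyEval α n x)))) ⟩
      A α n (1# - x) - sign n * A α n x
        ≈⟨ +-congʳ (α-sym n x) ⟩
      sign n * A α n x - sign n * A α n x
        ≈⟨ -‿inverseʳ _ ⟩
      0# ∎

  ω-closedForm : ∀ α → Symmetric α → ∀ n k → k ≤ n →
    ω α n k ≈ sign n * ((k !) · sumTo k (λ ν → ((k +ℕ k ∸ ν) C k) · coeffA α n ν))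
  ω-closedForm α α-sym n k k≤n = begin
    ω α n k
      ≈⟨ ω≈sumTo-newton α n k ⟩
    sumTo k (λ j → newtonWeight k (natR (k +ℕ k)) j * sumTo n (λ ν → (ν C j) · coeffA α n ν))
      ≈⟨ sumTo-cong≤ k term ⟩
    sumTo k (λ j → sign n * ((k !) · (((k +ℕ k ∸ j) C k) · coeffA α n j)))
      ≈⟨ trans (*-congˡ (*-distribˡ-sumTo k _ _)) (*-distribˡ-sumTo k _ _) ⟨
    sign n * ((k !) · sumTo k (λ ν → ((k +ℕ k ∸ ν) C k) · coeffA α n ν)) ∎
    where
    term : ∀ j → j ≤ k → newtonWeight k (natR (k +ℕ k)) j * sumTo n (λ ν → (ν C j) · coeffA α n ν)
                        ≈ sign n * ((k !) · (((k +ℕ k ∸ j) C k) · coeffA α n j))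
    term j j≤k = begin
      (sign j * W) * S                        ≈⟨ solve 3 (λ s w t → (s :* w) :* t := w :* (s :* t)) refl (sign j) W S ⟩
      W * (sign j * S)                        ≈⟨ *-cong (falling-k-j*falling-2k-j k j j≤k) (symmetric-coeffA α α-sym n j (ℕP.≤-trans j≤k k≤n)) ⟩
      natR (k ! *ℕ b) * (sign n * coeffA α n j) ≈⟨ *-congʳ (natR-* (k !) b) ⟩
      (natR (k !) * natR b) * (sign n * coeffA α n j)
        ≈⟨ solve 4 (λ f b s γ → (f :* b) :* (s :* γ) := s :* (f :* (b :* γ))) refl (natR (k !)) (natR b) (sign n) (coeffA α n j) ⟩
      sign n * ((k !) · (b · coeffA α n j))  ∎
      where
      W = falling (natR k) j * falling (natR (k +ℕ k) - natR j) (k ∸ j)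
      S = sumTo n (λ ν → (ν C j) · coeffA α n ν)
      b = (k +ℕ k ∸ j) C k

  -- h_{n,k} / k! for n = 2m + 1.
  quotientCoeff : (ℕ → Carrier) → ℕ → ℕ → Carrier
  quotientCoeff α m k = ½ * sumTo (suc (2 *ℕ m)) (λ ν → fibCoeff ν k · coeffA α (suc (2 *ℕ m)) ν)

  2m+1≤m+m+1 : ∀ m → suc (2 *ℕ m) ≤ suc (m +ℕ m)
  2m+1≤m+m+1 m = ℕP.≤-reflexive (≡.cong (λ t → suc (m +ℕ t)) (ℕP.+-identityʳ m))

  quotientCoeff-supported : ∀ α m → SupportedBy m (quotientCoeff α m)
  quotientCoeff-supported α m k m<k =
    trans (*-congˡ (sumTo-zero (suc (2 *ℕ m)) (λ ν ν≤2m+1 →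
      trans (*-congʳ (reflexive (≡.cong natR (fibCoeff-vanishes ν k (ν≤2k ν ν≤2m+1))))) (zeroˡ _))))
          (zeroʳ ½)
    where
    ν≤2k : ∀ ν → ν ≤ suc (2 *ℕ m) → ν ≤ k +ℕ k
    ν≤2k ν ν≤2m+1 = ℕP.≤-trans (ℕP.≤-trans ν≤2m+1 (2m+1≤m+m+1 m)) (ℕP.+-mono-≤ m<k (ℕP.<⇒≤ m<k))

  quotientCoeff-factorises : ∀ α → Symmetric α → ∀ m x →
    A α (suc (2 *ℕ m)) x ≈ (2 · x - 1#) * polyEval m (quotientCoeff α m) (x * (x - 1#))
  quotientCoeff-factorises α α-sym m x = begin
    A α n x                                   ≈⟨ ½*2x≈x _ ⟨
    ½ * (natR 2 * A α n x)                    ≈⟨ *-congˡ (solve 1 (λ a → con (ℤ.+ 2) :* a := a :- (:- a)) refl (A α n x)) ⟩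
    ½ * (A α n x - - A α n x)                 ≈⟨ *-congˡ (+-congˡ (-‿cong (trans (α-sym n x) (trans (*-congʳ (sign-odd m)) (-1*x≈-x _))))) ⟨
    ½ * (A α n x - A α n (1# - x))            ≈⟨ *-congˡ (A-A[1-x]≈fibPoly α n m x (2m+1≤m+m+1 m)) ⟩
    ½ * ((2 · x - 1#) * polyEval m S u)       ≈⟨ x∙yz≈y∙xz ½ (2 · x - 1#) _ ⟩
    (2 · x - 1#) * (½ * polyEval m S u)       ≈⟨ *-congˡ (polyEval-*ˡ m ½ S u) ⟨
    (2 · x - 1#) * polyEval m (quotientCoeff α m) u ∎
    where
    n = suc (2 *ℕ m)
    u = x * (x - 1#)
    S = λ k → sumTo n (λ ν → fibCoeff ν k · coeffA α n ν)

  quotientCoeff-unique : ∀ α → Symmetric α → ∀ m (cf : ℕ → Carrier) d → SupportedBy d cf →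
    (∀ x → A α (suc (2 *ℕ m)) x ≈ (2 · x - 1#) * polyEval d cf (x * (x - 1#))) → ∀ k → cf k ≈ quotientCoeff α m k
  quotientCoeff-unique α α-sym m cf d cf-supp cf-factorises =
    supported-polyEval-unique cancel cf (quotientCoeff α m) pts distinct cf-supp (quotientCoeff-supported α m) agree
    where
    x : ℕ → Carrier
    x j = natR (suc j)
    pts : ℕ → Carrier
    pts j = x j * (x j - 1#)
    pts≈ : ∀ j → pts j ≈ natR (suc j *ℕ j)
    pts≈ j = trans (*-congˡ ([1+x]-1≈x (natR j))) (sym (natR-* (suc j) j))
    distinct : ∀ i j → i < j → ¬ pts i ≈ pts j
    distinct i j i<j pᵢ≈pⱼ = natR-<⇒≉ (ℕP.*-mono-< (s≤s i<j) i<j) (trans (sym (pts≈ i)) (trans pᵢ≈pⱼ (pts≈ j)))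
    2x-1≉0 : ∀ j → ¬ 2 · x j - 1# ≈ 0#
    2x-1≉0 j 2x-1≈0 = charZero (j +ℕ j) (begin
      natR (suc (j +ℕ j))                       ≈⟨ +-congʳ 1#≈natR1 ⟩
      natR 1 + natR (j +ℕ j)                    ≈⟨ +-congˡ (natR-+ j j) ⟩
      natR 1 + (natR j + natR j)
        ≈⟨ solve 1 (λ J → con (ℤ.+ 1) :+ (J :+ J) := con (ℤ.+ 2) :* (con (ℤ.+ 1) :+ J) :- con (ℤ.+ 1)) refl (natR j) ⟩
      natR 2 * (natR 1 + natR j) - natR 1       ≈⟨ +-cong (*-congˡ (+-congʳ 1#≈natR1)) (-‿cong 1#≈natR1) ⟨
      2 · x j - 1#                              ≈⟨ 2x-1≈0 ⟩
      0#                                        ∎)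
    agree : ∀ j → polyEval d cf (pts j) ≈ polyEval m (quotientCoeff α m) (pts j)
    agree j = *-cancelˡ (2x-1≉0 j) (trans (sym (cf-factorises (x j))) (quotientCoeff-factorises α α-sym m (x j)))

  quotientCoeff-ω : ∀ α → Symmetric α → ∀ m k → k ≤ m → (k !) · quotientCoeff α m k ≈ sign k * ω α (suc (2 *ℕ m)) k
  quotientCoeff-ω α α-sym m k k≤m = begin
    natR (k !) * (½ * S)                    ≈⟨ x∙yz≈y∙xz (natR (k !)) ½ S ⟩
    ½ * (natR (k !) * S)                    ≈⟨ *-congˡ k!S≈2ω ⟩
    ½ * (natR 2 * (sign k * ω α n k))       ≈⟨ ½*2x≈x _ ⟩
    sign k * ω α n k                        ∎
    where
    n = suc (2 *ℕ m)
    γ = coeffA α n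
    S = sumTo n (λ ν → fibCoeff ν k · γ ν)
    T = (k !) · sumTo k (λ ν → ((k +ℕ k ∸ ν) C k) · γ ν)
    g : ℕ → Carrier
    g ν = sign k * (falling (natR (k +ℕ k) - natR ν) k * γ ν)
    k≤n : k ≤ n
    k≤n = ℕP.≤-trans k≤m (ℕP.≤-trans (ℕP.m≤m+n m (m +ℕ 0)) (ℕP.n≤1+n _))
    low : ∀ ν → ν ≤ k → natR (k !) * (fibCoeff ν k · γ ν) ≈ 0#
    low ν ν≤k = trans (*-congˡ (trans (*-congʳ (reflexive (≡.cong natR (fibCoeff-vanishes ν k (ℕP.≤-trans ν≤k (ℕP.m≤m+n k k))))))
                                      (zeroˡ _)))
                      (zeroʳ _)
    high : ∀ ν → k < ν → natR (k !) * (fibCoeff ν k · γ ν) ≈ g ν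
    high ν k<ν = trans (sym (*-assoc _ _ _)) (trans (*-congʳ (fibCoeff-falling ν k k<ν)) (*-assoc _ _ _))
    Σg≈ : sumTo n g ≈ sign k * ω α n k
    Σg≈ = trans (sym (*-distribˡ-sumTo n (sign k) _)) (*-congˡ (sym (ω≈sumTo-falling α n k)))
    Σg≤k≈ : sumTo k g ≈ sign k * T
    Σg≤k≈ = begin
      sumTo k g                                                                 ≈⟨ *-distribˡ-sumTo k (sign k) _ ⟨
      sign k * sumTo k (λ ν → falling (natR (k +ℕ k) - natR ν) k * γ ν)
        ≈⟨ *-congˡ (sumTo-cong≤ k (λ ν ν≤k → trans (*-congʳ (trans (falling-2k-ν k ν (ℕP.≤-trans ν≤k (ℕP.m≤m+n k k))) (natR-* (k !) _)))
                                                   (*-assoc _ _ _))) ⟩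
      sign k * sumTo k (λ ν → natR (k !) * (((k +ℕ k ∸ ν) C k) · γ ν))         ≈⟨ *-congˡ (*-distribˡ-sumTo k _ _) ⟨
      sign k * T                                                                ∎
    T≈-ω : T ≈ - ω α n k
    T≈-ω = begin
      T                       ≈⟨ -‿involutive T ⟨
      - - T                   ≈⟨ -‿cong (-1*x≈-x T) ⟨
      - (- 1# * T)            ≈⟨ -‿cong (*-congʳ (sign-odd m)) ⟨
      - (sign n * T)          ≈⟨ -‿cong (ω-closedForm α α-sym n k k≤n) ⟨
      - ω α n k               ∎
    k!S≈2ω : natR (k !) * S ≈ natR 2 * (sign k * ω α n k)
    k!S≈2ω = begin
      natR (k !) * S                                 ≈⟨ *-distribˡ-sumTo n _ _ ⟩
      sumTo n (λ ν → natR (k !) * (fibCoeff ν k · γ ν)) ≈⟨ sumTo-tail k≤n low high ⟩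
      sumTo n g - sumTo k g                          ≈⟨ +-cong Σg≈ (-‿cong (trans Σg≤k≈ (*-congˡ T≈-ω))) ⟩
      sign k * ω α n k - sign k * - ω α n k          ≈⟨ solve 2 (λ s w → s :* w :- s :* (:- w) := con (ℤ.+ 2) :* (s :* w)) refl (sign k) (ω α n k) ⟩
      natR 2 * (sign k * ω α n k)                    ∎

theorem5p2 : ∀ {c ℓ} (K : CharZeroField c ℓ) →
  let open CommutativeRing (CharZeroField.ring K)
      open Poly (CharZeroField.ring K)
  in (α : ℕ → Carrier) →
     (∀ m x → A α m (1# - x) ≈ sign m * A α m x) →
     (∀ n k → k ≤ n →
        ω α n k ≈ sign n * ((k !) · sumTo k (λ ν → ((k +ℕ k ∸ ν) C k) · ((n C ν) · α (n ∸ ν)))))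
     × (∀ n k → 2 ≤ n → k ≤ n ∸ 2 →
        ω α n (k +ℕ 2) ≈ ((4 *ℕ k +ℕ 6) · ω α n (k +ℕ 1)) + ((n *ℕ (n ∸ 1)) · ω α (n ∸ 2) k))
     × (∀ m → ∃ λ (cf : ℕ → Carrier) → ∃ λ (d : ℕ) →
          SupportedBy d cf
          × (∀ x → A α (suc (2 *ℕ m)) x ≈ ((2 · x - 1#) * polyEval d cf (x * (x - 1#))))
          × (∀ (cf′ : ℕ → Carrier) (d′ : ℕ) → SupportedBy d′ cf′ →
               (∀ x → A α (suc (2 *ℕ m)) x ≈ ((2 · x - 1#) * polyEval d′ cf′ (x * (x - 1#)))) →
               ∀ k → cf′ k ≈ cf k)
          × (∀ k → k ≤ m → ((k !) · cf k) ≈ sign k * ω α (suc (2 *ℕ m)) k))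
theorem5p2 K α α-sym =
    ω-closedForm α α-sym
  , (λ n k 2≤n _ → ω-recurrence α n k 2≤n)      -- the recurrence holds for every k
  , λ m → quotientCoeff α m , m
        , quotientCoeff-supported α m
        , quotientCoeff-factorises α α-sym m
        , quotientCoeff-unique α α-sym m
        , quotientCoeff-ω α α-sym m
  where
  open CharZero K
  open Identities (CharZeroField.ring K)
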